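{- Fix an integer $\Delta\geq 2$ and a real number $r\in(0,1)$. Let $\beta := \frac{\Delta-1}{r}$ and $c:= \left\lceil\beta + \frac{\Delta}{(1-r)^2}\right\rceil$. Then for every $(\geq 1)$-subdivision $G$ of a graph with maximum degree $\Delta$, for every $c$-list-assignment $L$ of $G$, and for every vertex $v$ of $G$, $$\Pi(G,L) \geq \beta\, \Pi(G-v,L).$$
   Context: All graphs are finite, simple and undirected. A path is a sequence of pairwise distinct vertices, consecutive ones adjacent. Given a colouring $\phi$, a sequence $(v_1,\dots,v_{2t})$ is repetitively coloured if $\phi(v_i)=\phi(v_{t+i})$ for all $i\in\{1,\dots,t\}$; a colouring is nonrepetitive if no path is repetitively coloured. A $c$-list-assignment $L$ assigns to each vertex $v$ a set $L(v)$ with $|L(v)|\ge c$; an $L$-colouring is a colouring $\phi$ with $\phi(v)\in L(v)$ for all $v$. $\Pi(G,L)$ denotes the number of nonrepetitive $L$-colourings of $G$, with the convention $\Pi(G,L)=1$ when $G$ has no vertices. A $(\geq 1)$-subdivision of a graph $H$ is obtained by replacing each edge $vw$ of $H$ by a path from $v$ to $w$ with at least one internal vertex, these paths being internally disjoint.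
   Formalization: The parameter r is a rational number in $(0,1)$ rather than a real number. -}

module Defs where

open import Data.Bool using (Bool; true; false; T; if_then_else_)
open import Data.Nat as ℕ using (ℕ; zero; suc)
open import Data.Fin using (Fin; punchIn; _<_)
open import Data.List using (List; []; _∷_; _++_; [_]; map; allFin; length)
open import Data.Nat.ListAction using (sum)
open import Data.List.Membership.Propositional using (_∈_)
open import Data.List.Relation.Unary.Unique.Propositional using (Unique)
open import Data.List.Relation.Unary.Linked using (Linked)
open import Data.List.Relation.Unary.All using (All)
open import Data.Vec using (Vec; lookup)
open import Data.Product using (Σ; ∃; ∃-syntax; _×_; _,_)
open import Data.Sum using (_⊎_)
open import Data.Integer using (ℤ; +_)
open import Data.Rational as ℚ using (ℚ; 0ℚ; 1ℚ; _/_; 1/_; ceiling; >-nonZero)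
import Data.Rational.Properties as ℚP
open import Relation.Binary.PropositionalEquality using (_≡_; _≢_; refl; subst)
open import Relation.Nullary using (¬_)

record Graph (n : ℕ) : Set where
  field
    adj    : Fin n → Fin n → Bool
    sym    : ∀ x y → adj x y ≡ adj y x
    irrefl : ∀ x → adj x x ≡ false

open Graph public

Adj : ∀ {n} → Graph n → Fin n → Fin n → Set
Adj G x y = T (adj G x y)

degree : ∀ {n} → Graph n → Fin n → ℕ
degree {n} G x = sum (map (λ y → if adj G x y then 1 else 0) (allFin n))

MaxDegree : ∀ {n} → Graph n → ℕ → Set
MaxDegree {n} G Δ = (∀ x → degree G x ℕ.≤ Δ) × (∃[ x ] degree G x ≡ Δ)

_-v_ : ∀ {n} → Graph (suc n) → Fin (suc n) → Graph n
G -v v = record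
  { adj    = λ x y → adj G (punchIn v x) (punchIn v y)
  ; sym    = λ x y → sym G (punchIn v x) (punchIn v y)
  ; irrefl = λ x → irrefl G (punchIn v x)
  }

IsPath : ∀ {n} → Graph n → List (Fin n) → Set
IsPath G p = Unique p × Linked (Adj G) p

Consecutive : ∀ {n} → Fin n → Fin n → List (Fin n) → Set
Consecutive z w p = ∃[ as ] ∃[ bs ] p ≡ as ++ (z ∷ w ∷ bs)

-- G is a (≥1)-subdivision of H: H's vertices are embedded injectively as
-- branch vertices of G; every edge xy of H (x < y) is replaced by the path
--   branch x ∷ inner x y ++ [ branch y ]
-- in G with at least one internal vertex; the internal vertices are not
-- branch vertices and the paths are internally disjoint; and G consists
-- of exactly these vertices and the edges of these paths.

record Subdivision {k m : ℕ} (H : Graph k) (G : Graph m) : Set where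
  field
    branch       : Fin k → Fin m
    branch-inj   : ∀ x y → branch x ≡ branch y → x ≡ y
    inner        : Fin k → Fin k → List (Fin m)
    is-path      : ∀ x y → x < y → Adj H x y →
                   IsPath G (branch x ∷ inner x y ++ [ branch y ])
    inner-ne     : ∀ x y → x < y → Adj H x y → inner x y ≢ []
    inner-branch : ∀ x y → x < y → Adj H x y →
                   ∀ z → z ∈ inner x y → ∀ u → branch u ≢ z
    disjoint     : ∀ x y x′ y′ → x < y → x′ < y′ → Adj H x y → Adj H x′ y′ →
                   ∀ z → z ∈ inner x y → z ∈ inner x′ y′ → (x ≡ x′) × (y ≡ y′)
    cover-vertex : ∀ z → (∃[ u ] branch u ≡ z)
                         ⊎ (∃[ x ] ∃[ y ] (x < y) × Adj H x y × z ∈ inner x y)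
    cover-edge   : ∀ z w → Adj G z w →
                   ∃[ x ] ∃[ y ] (x < y) × Adj H x y ×
                     (Consecutive z w (branch x ∷ inner x y ++ [ branch y ])
                      ⊎ Consecutive w z (branch x ∷ inner x y ++ [ branch y ]))

Colouring : ℕ → Set
Colouring n = Vec ℕ n

-- a list assignment: L v is a duplicate-free list, i.e. a finite set
ListAssignment : ℕ → Set
ListAssignment n = Fin n → List ℕ

IsListAssignment : ∀ {n} → ℤ → ListAssignment n → Set
IsListAssignment c L = ∀ v → Unique (L v) × (c Data.Integer.≤ + length (L v))

IsLColouring : ∀ {n} → ListAssignment n → Colouring n → Set
IsLColouring L φ = ∀ v → lookup φ v ∈ L v

RepetitivelyColoured : ∀ {n} → Colouring n → List (Fin n) → Set
RepetitivelyColoured φ p =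
  ∃[ as ] ∃[ bs ] (p ≡ as ++ bs) × (as ≢ []) × (length as ≡ length bs)
                × (map (lookup φ) as ≡ map (lookup φ) bs)

Nonrepetitive : ∀ {n} → Graph n → Colouring n → Set
Nonrepetitive G φ = ∀ p → IsPath G p → ¬ RepetitivelyColoured φ p

NonrepLColouring : ∀ {n} → Graph n → ListAssignment n → Colouring n → Set
NonrepLColouring G L φ = IsLColouring L φ × Nonrepetitive G φ

-- xs is an exact enumeration (without repetition) of the elements
-- satisfying P; hence length xs is "the number of" such elements.
record Enumerates {A : Set} (P : A → Set) (xs : List A) : Set where
  field
    unique   : Unique xs
    sound    : All P xs
    complete : ∀ a → P a → a ∈ xs

ℕ→ℚ : ℕ → ℚ
ℕ→ℚ n = + n / 1

private
  1-r>0 : ∀ r → r ℚ.< 1ℚ → 0ℚ ℚ.< (1ℚ ℚ.- r)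
  1-r>0 r r<1 = subst (ℚ._< (1ℚ ℚ.- r)) (ℚP.+-inverseʳ r) (ℚP.+-monoˡ-< (ℚ.- r) r<1)

beta : (Δ : ℕ) (r : ℚ) → 0ℚ ℚ.< r → ℚ
beta Δ r r>0 = ℕ→ℚ (Δ ℕ.∸ 1) ℚ.* (1/ r) {{>-nonZero r>0}}

cBound : (Δ : ℕ) (r : ℚ) → 0ℚ ℚ.< r → r ℚ.< 1ℚ → ℤ
cBound Δ r r>0 r<1 =
  ceiling (beta Δ r r>0 ℚ.+ ℕ→ℚ Δ ℚ.* (1/ s) {{>-nonZero s>0}} ℚ.* (1/ s) {{>-nonZero s>0}})
  where
  s = 1ℚ ℚ.- r
  s>0 = 1-r>0 r r<1

{-# OPTIONS --safe #-}

-- For a vertex set U let Π U count the nonrepetitive L-colourings of G[U]; we prove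
-- β · Π (U - v) ≤ Π U for every v ∈ U by induction on |U|.  Of the |L v| · Π (U - v)
-- extensions of colourings of G[U - v] to v, those that are not colourings of G[U] contain a
-- repetitively coloured path through v, and such an extension is determined by the half S of
-- the path containing v, the other half, and its restriction to U - S.  In a subdivision of a
-- graph of maximum degree Δ, the paths on 2t vertices through v are non-backtracking walks,
-- at most t Δ d^(t-1) of them with d = Δ - 1, while by induction
-- Π (U - S) ≤ β^(1-t) Π (U - v) = (r / d)^(t-1) Π (U - v).  Hence at most
-- Δ Σₜ t r^(t-1) Π (U - v) ≤ Δ / (1 - r)² · Π (U - v) extensions are bad, and
-- |L v| ≥ β + Δ / (1 - r)² leaves at least β Π (U - v) good ones.

module Submission where

open import Algebra.Bundles using (CommutativeMonoid)
open import Data.Bool using (Bool; true; false; T; not; _∧_; if_then_else_)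
open import Data.Empty using (⊥; ⊥-elim)
open import Data.Fin as Fin using (Fin; punchIn; punchOut)
import Data.Fin.Properties as Finₚ
import Data.Integer as ℤ
import Data.Integer.DivMod as ℤ÷
import Data.Integer.Properties as ℤₚ
open import Data.List
  using (List; []; _∷_; _++_; [_]; map; length; concatMap; filter; allFin; reverse; splitAt; upTo; downFrom)
import Data.List.Properties as Listₚ
open import Data.List.Membership.Propositional using (_∈_; _∉_; lose; find)
open import Data.List.Membership.Propositional.Properties
open import Data.List.Relation.Unary.All as All using (All; []; _∷_)
import Data.List.Relation.Unary.All.Properties as Allₚ
open import Data.List.Relation.Unary.AllPairs as AllPairs using ([]; _∷_)
open import Data.List.Relation.Unary.Any as Any using (Any; here; there)
import Data.List.Relation.Unary.Any.Properties as Anyₚ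
open import Data.List.Relation.Unary.Linked as Linked using (Linked; []; [-]; _∷_)
import Data.List.Relation.Unary.Linked.Properties as Linkedₚ
open import Data.List.Relation.Unary.Unique.Propositional using (Unique)
import Data.List.Relation.Unary.Unique.Propositional.Properties as Uniqueₚ
open import Data.Maybe using (Maybe; just; nothing)
open import Data.Nat as ℕ using (ℕ; zero; suc; _+_; _*_; _∸_; _^_; _≤_; _<_; z≤n; s≤s; ⌊_/2⌋; ⌈_/2⌉)
open import Data.Nat.ListAction using (sum)
import Data.Nat.ListAction.Properties as ListActionₚ
import Data.Nat.Properties as ℕₚ
open import Data.Product using (∃; ∃-syntax; _×_; _,_; proj₁; proj₂; map₁)
open import Data.Rational as ℚ using (ℚ; 0ℚ; 1ℚ; mkℚ; ↥_; ↧_)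
import Data.Rational.Properties as ℚₚ
open import Algebra.Properties.CommutativeSemigroup ℕₚ.+-commutativeSemigroup using (interchange)
open import Algebra.Properties.CommutativeSemigroup (CommutativeMonoid.commutativeSemigroup ℚₚ.*-1-commutativeMonoid)
  using (xy∙z≈y∙xz)
open import Data.Rational.Solver using (module +-*-Solver)
import Data.Rational.Unnormalised as ℚᵘ
import Data.Rational.Unnormalised.Properties as ℚᵘₚ
open import Data.Sum using (_⊎_; inj₁; inj₂; [_,_]′)
open import Data.Unit using (⊤; tt)
open import Data.Vec as Vec using (Vec; lookup)
import Data.Vec.Properties as Vecₚ
open import Function using (_∘_)
open import Relation.Binary.PropositionalEquality
  using (_≡_; _≢_; _≗_; refl; sym; trans; cong; cong₂; subst; subst₂; module ≡-Reasoning)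
open import Relation.Nullary using (¬_; Dec; yes; no; ¬?; does)
open import Relation.Nullary.Decidable using (_×-dec_; _→-dec_; map′; T?)

open import Defs hiding (sym)

private
  variable
    A B : Set
    k m n : ℕ

Unique⇒length-mono-⊆ : ∀ {xs ys : List A} → Unique xs → (∀ {x} → x ∈ xs → x ∈ ys) →
                       length xs ≤ length ys
Unique⇒length-mono-⊆ {xs = []} _ _ = z≤n
Unique⇒length-mono-⊆ {xs = x ∷ xs} (x∉xs ∷ !xs) xs⊆ys with ∈-∃++ (xs⊆ys (here refl))
... | ys₁ , ys₂ , refl = begin
  suc (length xs)           ≤⟨ s≤s (Unique⇒length-mono-⊆ !xs xs⊆ys₁ys₂) ⟩
  suc (length (ys₁ ++ ys₂)) ≡⟨ sym (Listₚ.length-++-sucʳ ys₁ x ys₂) ⟩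
  length (ys₁ ++ x ∷ ys₂)   ∎
  where
  open ℕₚ.≤-Reasoning
  drop-x : ∀ ys₁ {z} → z ∈ ys₁ ++ x ∷ ys₂ → z ≢ x → z ∈ ys₁ ++ ys₂
  drop-x []         (here z≡x)   z≢x = ⊥-elim (z≢x z≡x)
  drop-x []         (there z∈)   _   = z∈
  drop-x (y ∷ ys₁) (here z≡y)   _   = here z≡y
  drop-x (y ∷ ys₁) (there z∈)   z≢x = there (drop-x ys₁ z∈ z≢x)
  xs⊆ys₁ys₂ : ∀ {z} → z ∈ xs → z ∈ ys₁ ++ ys₂
  xs⊆ys₁ys₂ z∈xs = drop-x ys₁ (xs⊆ys (there z∈xs)) λ { refl → All.lookup x∉xs z∈xs refl }

Unique-++⁻ : ∀ (xs : List A) {ys} → Unique (xs ++ ys) →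
             Unique xs × Unique ys × (∀ {z} → z ∈ xs → z ∈ ys → ⊥)
Unique-++⁻ []       !ys            = [] , !ys , λ ()
Unique-++⁻ (x ∷ xs) (x∉ ∷ !xs++ys) with Unique-++⁻ xs !xs++ys
... | !xs , !ys , xs#ys = Allₚ.++⁻ˡ xs x∉ ∷ !xs , !ys , disjoint
  where
  disjoint : ∀ {z} → z ∈ x ∷ xs → z ∈ _ → ⊥
  disjoint (here refl) z∈ys = All.lookup (Allₚ.++⁻ʳ xs x∉) z∈ys refl
  disjoint (there z∈xs) z∈ys = xs#ys z∈xs z∈ys

Unique-reverse : ∀ {xs : List A} → Unique xs → Unique (reverse xs)
Unique-reverse {xs = []}     []          = []
Unique-reverse {xs = x ∷ xs} (x∉ ∷ !xs) rewrite Listₚ.unfold-reverse x xs =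
  Uniqueₚ.++⁺ (Unique-reverse !xs) ([] ∷ [])
    λ { (z∈ , here refl) → All.lookup x∉ (Anyₚ.reverse⁻ z∈) refl }

Unique-drop-middle : ∀ (xs : List A) {y} ys → Unique (xs ++ y ∷ ys) → Unique (xs ++ ys)
Unique-drop-middle xs ys !xs++y∷ys with Unique-++⁻ xs !xs++y∷ys
... | !xs , _ ∷ !ys , xs#y∷ys = Uniqueₚ.++⁺ !xs !ys λ (z∈xs , z∈ys) → xs#y∷ys z∈xs (there z∈ys)

Unique-concatMap : ∀ (f : A → List B) {xs} → Unique xs → (∀ {x} → x ∈ xs → Unique (f x)) →
                   (∀ {x y b} → x ∈ xs → y ∈ xs → b ∈ f x → b ∈ f y → x ≡ y) →
                   Unique (concatMap f xs)
Unique-concatMap f {[]}     _           _    _        = []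
Unique-concatMap f {x ∷ xs} (x∉ ∷ !xs) !f   f-disj =
  Uniqueₚ.++⁺ (!f (here refl)) (Unique-concatMap f !xs (!f ∘ there) λ x∈ y∈ → f-disj (there x∈) (there y∈))
    λ (b∈fx , b∈rest) → let y , y∈xs , b∈fy = find (∈-concatMap⁻ f {xs = xs} b∈rest)
                        in All.lookup x∉ y∈xs (f-disj (here refl) (there y∈xs) b∈fx b∈fy)

length-concatMap-≤ : ∀ (f : A → List B) xs k → (∀ {x} → x ∈ xs → length (f x) ≤ k) →
                     length (concatMap f xs) ≤ length xs * k
length-concatMap-≤ f []       k _     = z≤n
length-concatMap-≤ f (x ∷ xs) k |f|≤k = ℕₚ.≤-trans (ℕₚ.≤-reflexive (Listₚ.length-++ (f x)))
  (ℕₚ.+-mono-≤ (|f|≤k (here refl)) (length-concatMap-≤ f xs k (|f|≤k ∘ there)))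

length-concatMap : ∀ (f : A → List B) xs → length (concatMap f xs) ≡ sum (map (length ∘ f) xs)
length-concatMap f []       = refl
length-concatMap f (x ∷ xs) = trans (Listₚ.length-++ (f x)) (cong (length (f x) +_) (length-concatMap f xs))

-- Linkedness as a property of every consecutive pair, which is how it survives reversal.

AllConsecutive : (A → A → Set) → List A → Set
AllConsecutive R p = ∀ as a b bs → p ≡ as ++ a ∷ b ∷ bs → R a b

Linked⇒AllConsecutive : ∀ {R : A → A → Set} {p} → Linked R p → AllConsecutive R p
Linked⇒AllConsecutive (Rxy ∷ _)     []       _ _ _ refl = Rxy
Linked⇒AllConsecutive (_ ∷ Rp)      (_ ∷ as) a b bs p≡ = Linked⇒AllConsecutive Rp as a b bs (Listₚ.∷-injectiveʳ p≡)
Linked⇒AllConsecutive [-] (_ ∷ _ ∷ _) _ _ _ ()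
Linked⇒AllConsecutive [-] (_ ∷ [])    _ _ _ ()

AllConsecutive⇒Linked : ∀ {R : A → A → Set} p → AllConsecutive R p → Linked R p
AllConsecutive⇒Linked []          _  = []
AllConsecutive⇒Linked (x ∷ [])    _  = [-]
AllConsecutive⇒Linked (x ∷ y ∷ p) Rp =
  Rp [] x y p refl ∷ AllConsecutive⇒Linked (y ∷ p) λ as a b bs p≡ → Rp (x ∷ as) a b bs (cong (x ∷_) p≡)

Linked-++⁻ˡ : ∀ {R : A → A → Set} xs {ys} → Linked R (xs ++ ys) → Linked R xs
Linked-++⁻ˡ []           _          = []
Linked-++⁻ˡ (x ∷ [])     _          = [-]
Linked-++⁻ˡ (x ∷ y ∷ xs) (Rxy ∷ Rp) = Rxy ∷ Linked-++⁻ˡ (y ∷ xs) Rp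

Linked-++⁻ʳ : ∀ {R : A → A → Set} xs {ys} → Linked R (xs ++ ys) → Linked R ys
Linked-++⁻ʳ []       Rp = Rp
Linked-++⁻ʳ (x ∷ xs) Rp = Linked-++⁻ʳ xs (Linked.tail Rp)

reverse-middle : ∀ (as : List A) a b bs → reverse (as ++ a ∷ b ∷ bs) ≡ reverse bs ++ b ∷ a ∷ reverse as
reverse-middle as a b bs = begin
  reverse (as ++ a ∷ b ∷ bs)              ≡⟨ Listₚ.reverse-++ as (a ∷ b ∷ bs) ⟩
  reverse (a ∷ b ∷ bs) ++ reverse as      ≡⟨ cong (_++ reverse as) (Listₚ.reverse-++ (a ∷ [ b ]) bs) ⟩
  (reverse bs ++ b ∷ [ a ]) ++ reverse as ≡⟨ Listₚ.++-assoc (reverse bs) (b ∷ [ a ]) (reverse as) ⟩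
  reverse bs ++ b ∷ a ∷ reverse as        ∎
  where open ≡-Reasoning

Linked-reverse : ∀ {R : A → A → Set} → (∀ {x y} → R x y → R y x) → ∀ {p} → Linked R p → Linked R (reverse p)
Linked-reverse R-sym {p} Rp = AllConsecutive⇒Linked (reverse p) λ as a b bs rp≡ →
  R-sym (Linked⇒AllConsecutive Rp (reverse bs) b a (reverse as) (begin
    p                                           ≡⟨ Listₚ.reverse-involutive p ⟨
    reverse (reverse p)                         ≡⟨ cong reverse rp≡ ⟩
    reverse (as ++ a ∷ b ∷ bs)                  ≡⟨ reverse-middle as a b bs ⟩
    reverse bs ++ b ∷ a ∷ reverse as            ∎))
  where open ≡-Reasoning

length-concatMap-const : ∀ (f : A → List B) xs k → (∀ {x} → x ∈ xs → length (f x) ≡ k) →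
                         length (concatMap f xs) ≡ length xs * k
length-concatMap-const f []       k _     = refl
length-concatMap-const f (x ∷ xs) k |f|≡k =
  trans (Listₚ.length-++ (f x)) (cong₂ _+_ (|f|≡k (here refl)) (length-concatMap-const f xs k (|f|≡k ∘ there)))

Enumerates-length-mono : ∀ {P Q : A → Set} {xs ys} → Enumerates P xs → Enumerates Q ys →
                         (∀ a → P a → Q a) → length xs ≤ length ys
Enumerates-length-mono xs-enum ys-enum P⇒Q = Unique⇒length-mono-⊆ (Enumerates.unique xs-enum)
  λ {x} x∈xs → Enumerates.complete ys-enum x (P⇒Q x (All.lookup (Enumerates.sound xs-enum) x∈xs))

Enumerates-length-cong : ∀ {P Q : A → Set} {xs ys} → Enumerates P xs → Enumerates Q ys →
                         (∀ a → P a → Q a) → (∀ a → Q a → P a) → length xs ≡ length ys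
Enumerates-length-cong xs-enum ys-enum P⇒Q Q⇒P =
  ℕₚ.≤-antisym (Enumerates-length-mono xs-enum ys-enum P⇒Q) (Enumerates-length-mono ys-enum xs-enum Q⇒P)

sum-map-concatMap : ∀ (g : B → ℕ) (f : A → List B) xs →
                    sum (map g (concatMap f xs)) ≡ sum (map (λ x → sum (map g (f x))) xs)
sum-map-concatMap g f []       = refl
sum-map-concatMap g f (x ∷ xs) = begin
  sum (map g (f x ++ concatMap f xs))               ≡⟨ cong sum (Listₚ.map-++ g (f x) (concatMap f xs)) ⟩
  sum (map g (f x) ++ map g (concatMap f xs))       ≡⟨ ListActionₚ.sum-++ (map g (f x)) _ ⟩
  sum (map g (f x)) + sum (map g (concatMap f xs))  ≡⟨ cong (sum (map g (f x)) +_) (sum-map-concatMap g f xs) ⟩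
  sum (map g (f x)) + sum (map (λ x → sum (map g (f x))) xs) ∎
  where open ≡-Reasoning

headOr : A → List A → A
headOr d []      = d
headOr d (x ∷ _) = x

headOr-∈ : ∀ d (xs : List A) → xs ≢ [] → headOr d xs ∈ xs
headOr-∈ d []      xs≢[] = ⊥-elim (xs≢[] refl)
headOr-∈ d (x ∷ _) _     = here refl

reverse≢[] : ∀ {xs : List A} → xs ≢ [] → reverse xs ≢ []
reverse≢[] {xs = xs} xs≢[] rev≡[] = xs≢[] (trans (sym (Listₚ.reverse-involutive xs)) (cong reverse rev≡[]))

∈-init : ∀ (I : List A) e as a b bs → I ++ [ e ] ≡ as ++ a ∷ b ∷ bs → a ∈ I
∈-init []      e []           a b bs ()
∈-init []      e (_ ∷ [])     a b bs ()
∈-init []      e (_ ∷ _ ∷ _)  a b bs ()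
∈-init (i ∷ I) e []           a b bs eq = here (sym (Listₚ.∷-injectiveˡ eq))
∈-init (i ∷ I) e (_ ∷ as)     a b bs eq = there (∈-init I e as a b bs (Listₚ.∷-injectiveʳ eq))

first-pair : ∀ (s : A) I e as a b bs → as ++ a ∷ b ∷ bs ≡ s ∷ I ++ [ e ] → a ∉ I → I ≢ [] →
             a ≡ s × b ≡ headOr s I
first-pair s []      e as       a b bs eq a∉I I≢[] = ⊥-elim (I≢[] refl)
first-pair s (i ∷ I) e []       a b bs eq a∉I I≢[] = Listₚ.∷-injectiveˡ eq , Listₚ.∷-injectiveˡ (Listₚ.∷-injectiveʳ eq)
first-pair s I       e (_ ∷ as) a b bs eq a∉I I≢[] = ⊥-elim (a∉I (∈-init I e as a b bs (sym (Listₚ.∷-injectiveʳ eq))))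

reverse-ends : ∀ (s : A) I e → reverse (s ∷ I ++ [ e ]) ≡ e ∷ reverse I ++ [ s ]
reverse-ends s I e = trans (Listₚ.unfold-reverse s (I ++ [ e ])) (cong (Data.List._∷ʳ s) (Listₚ.reverse-++ I [ e ]))

last-pair : ∀ (s : A) I e as a b bs → as ++ a ∷ b ∷ bs ≡ s ∷ I ++ [ e ] → b ∉ I → I ≢ [] →
            b ≡ e × a ≡ headOr e (reverse I)
last-pair s I e as a b bs eq b∉I I≢[] =
  first-pair e (reverse I) s (reverse bs) b a (reverse as)
    (trans (sym (reverse-middle as a b bs)) (trans (cong reverse eq) (reverse-ends s I e)))
    (b∉I ∘ Anyₚ.reverse⁻) (reverse≢[] I≢[])

∈-middle : ∀ {z s e : A} I → z ∈ s ∷ I ++ [ e ] → z ≢ s → z ≢ e → z ∈ I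
∈-middle I (here z≡s)  z≢s _   = ⊥-elim (z≢s z≡s)
∈-middle I (there z∈) _   z≢e with ∈-++⁻ I z∈
... | inj₁ z∈I        = z∈I
... | inj₂ (here z≡e) = ⊥-elim (z≢e z≡e)

map-≡-++⁻ : ∀ (f : A → B) q as bs → map f q ≡ as ++ bs →
            ∃[ q₁ ] ∃[ q₂ ] q ≡ q₁ ++ q₂ × map f q₁ ≡ as × map f q₂ ≡ bs
map-≡-++⁻ f q       []       bs eq = [] , q , refl , refl , eq
map-≡-++⁻ f (x ∷ q) (a ∷ as) bs eq with map-≡-++⁻ f q as bs (Listₚ.∷-injectiveʳ eq)
... | q₁ , q₂ , refl , refl , refl = x ∷ q₁ , q₂ , refl , cong (_∷ _) (Listₚ.∷-injectiveˡ eq) , refl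

ℕ→ℚ≃ : ∀ n → ℚ.toℚᵘ (ℕ→ℚ n) ℚᵘ.≃ ℚᵘ.mkℚᵘ (ℤ.+ n) 0
ℕ→ℚ≃ n = ℚₚ.toℚᵘ-fromℚᵘ (ℚᵘ.mkℚᵘ (ℤ.+ n) 0)

ℕ→ℚ-+ : ∀ a b → ℕ→ℚ (a + b) ≡ ℕ→ℚ a ℚ.+ ℕ→ℚ b
ℕ→ℚ-+ a b = ℚₚ.toℚᵘ-injective (ℚᵘₚ.≃-trans (ℕ→ℚ≃ (a + b)) (ℚᵘₚ.≃-trans unnormalised
  (ℚᵘₚ.≃-sym (ℚᵘₚ.≃-trans (ℚₚ.toℚᵘ-homo-+ (ℕ→ℚ a) (ℕ→ℚ b)) (ℚᵘₚ.+-cong (ℕ→ℚ≃ a) (ℕ→ℚ≃ b))))))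
  where
  unnormalised : ℚᵘ.mkℚᵘ (ℤ.+ (a + b)) 0 ℚᵘ.≃ ℚᵘ.mkℚᵘ (ℤ.+ a) 0 ℚᵘ.+ ℚᵘ.mkℚᵘ (ℤ.+ b) 0
  unnormalised = ℚᵘ.*≡* (cong (ℤ._* ℤ.+ 1) (cong₂ ℤ._+_ (sym (ℤₚ.*-identityʳ (ℤ.+ a))) (sym (ℤₚ.*-identityʳ (ℤ.+ b)))))

ℕ→ℚ-* : ∀ a b → ℕ→ℚ (a * b) ≡ ℕ→ℚ a ℚ.* ℕ→ℚ b
ℕ→ℚ-* a b = ℚₚ.toℚᵘ-injective (ℚᵘₚ.≃-trans (ℕ→ℚ≃ (a * b)) (ℚᵘₚ.≃-trans unnormalised
  (ℚᵘₚ.≃-sym (ℚᵘₚ.≃-trans (ℚₚ.toℚᵘ-homo-* (ℕ→ℚ a) (ℕ→ℚ b)) (ℚᵘₚ.*-cong (ℕ→ℚ≃ a) (ℕ→ℚ≃ b))))))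
  where
  unnormalised : ℚᵘ.mkℚᵘ (ℤ.+ (a * b)) 0 ℚᵘ.≃ ℚᵘ.mkℚᵘ (ℤ.+ a) 0 ℚᵘ.* ℚᵘ.mkℚᵘ (ℤ.+ b) 0
  unnormalised = ℚᵘ.*≡* (cong (ℤ._* ℤ.+ 1) (ℤₚ.pos-* a b))

ℕ→ℚ-nonNeg : ∀ n → 0ℚ ℚ.≤ ℕ→ℚ n
ℕ→ℚ-nonNeg n = ℚₚ.nonNegative⁻¹ (ℕ→ℚ n) {{ℚₚ.normalize-nonNeg n 1}}

ℕ→ℚ-mono-≤ : ∀ {a b} → a ≤ b → ℕ→ℚ a ℚ.≤ ℕ→ℚ b
ℕ→ℚ-mono-≤ {a} a≤b with ℕₚ.m≤n⇒∃[o]m+o≡n a≤b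
... | k , refl = subst (ℕ→ℚ a ℚ.≤_) (sym (ℕ→ℚ-+ a k))
  (subst (ℚ._≤ ℕ→ℚ a ℚ.+ ℕ→ℚ k) (ℚₚ.+-identityʳ (ℕ→ℚ a)) (ℚₚ.+-monoʳ-≤ (ℕ→ℚ a) (ℕ→ℚ-nonNeg k)))

ℕ→ℚ-pos : ∀ {n} → 0 < n → 0ℚ ℚ.< ℕ→ℚ n
ℕ→ℚ-pos 0<n = ℚₚ.<-≤-trans (ℚₚ.positive⁻¹ 1ℚ) (ℕ→ℚ-mono-≤ 0<n)

floor*↧≤↥ : ∀ p → ℚ.floor p ℤ.* ↧ p ℤ.≤ ↥ p
floor*↧≤↥ p@(mkℚ _ _ _) = ℤ÷.[n/d]*d≤n (↥ p) (↧ p)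

ceiling≤⇒≤ : ∀ p n → ℚ.ceiling p ℤ.≤ ℤ.+ n → p ℚ.≤ ℕ→ℚ n
ceiling≤⇒≤ p@(mkℚ _ _ _) n ⌈p⌉≤n = ℚₚ.toℚᵘ-cancel-≤ (ℚᵘₚ.≤-respʳ-≃ (ℚᵘₚ.≃-sym (ℕ→ℚ≃ n)) (ℚᵘ.*≤* ↥p≤n↧p))
  where
  -p : ℚ
  -p = ℚ.- p
  -n≤⌊-p⌋ : ℤ.- ℤ.+ n ℤ.≤ ℚ.floor -p
  -n≤⌊-p⌋ = subst (ℤ.- ℤ.+ n ℤ.≤_) (ℤₚ.neg-involutive _) (ℤₚ.neg-mono-≤ ⌈p⌉≤n)
  -n↧-p≤↥-p : ℤ.- ℤ.+ n ℤ.* ↧ -p ℤ.≤ ↥ -p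
  -n↧-p≤↥-p = ℤₚ.≤-trans (ℤₚ.*-monoʳ-≤-nonNeg (↧ -p) -n≤⌊-p⌋) (floor*↧≤↥ -p)
  ↥p≤n↧p : ↥ p ℤ.* ℤ.+ 1 ℤ.≤ ℤ.+ n ℤ.* ↧ p
  ↥p≤n↧p = subst₂ ℤ._≤_
    (trans (cong ℤ.-_ (ℚₚ.↥-neg p)) (trans (ℤₚ.neg-involutive (↥ p)) (sym (ℤₚ.*-identityʳ (↥ p)))))
    (trans (ℤₚ.neg-distribˡ-* (ℤ.- ℤ.+ n) (↧ -p)) (cong₂ ℤ._*_ (ℤₚ.neg-involutive (ℤ.+ n)) (ℚₚ.↧-neg p)))
    (ℤₚ.neg-mono-≤ -n↧-p≤↥-p)

*-monoˡ-≤-nonNeg : ∀ {p q} r → 0ℚ ℚ.≤ r → p ℚ.≤ q → r ℚ.* p ℚ.≤ r ℚ.* q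
*-monoˡ-≤-nonNeg r 0≤r = ℚₚ.*-monoˡ-≤-nonNeg r {{ℚ.nonNegative 0≤r}}

*-monoʳ-≤-nonNeg : ∀ {p q} r → 0ℚ ℚ.≤ r → p ℚ.≤ q → p ℚ.* r ℚ.≤ q ℚ.* r
*-monoʳ-≤-nonNeg r 0≤r = ℚₚ.*-monoʳ-≤-nonNeg r {{ℚ.nonNegative 0≤r}}

*-nonNeg : ∀ {p q} → 0ℚ ℚ.≤ p → 0ℚ ℚ.≤ q → 0ℚ ℚ.≤ p ℚ.* q
*-nonNeg {p} 0≤p 0≤q = subst (ℚ._≤ p ℚ.* _) (ℚₚ.*-zeroʳ p) (*-monoˡ-≤-nonNeg p 0≤p 0≤q)

+-cancelʳ-≤ : ∀ p q r → p ℚ.+ r ℚ.≤ q ℚ.+ r → p ℚ.≤ q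
+-cancelʳ-≤ p q r p+r≤q+r = subst₂ ℚ._≤_ (+-r p) (+-r q) (ℚₚ.+-monoˡ-≤ (ℚ.- r) p+r≤q+r)
  where
  open +-*-Solver
  +-r : ∀ x → x ℚ.+ r ℚ.- r ≡ x
  +-r x = solve 2 (λ x r → x :+ r :- r := x) refl x r

1/-pos : ∀ p (0<p : 0ℚ ℚ.< p) → 0ℚ ℚ.< (ℚ.1/ p) {{ℚ.>-nonZero 0<p}}
1/-pos p 0<p = ℚₚ.positive⁻¹ _ {{ℚₚ.1/pos⇒pos p {{ℚ.positive 0<p}}}}

pow : ℚ → ℕ → ℚ
pow p zero    = 1ℚ
pow p (suc k) = p ℚ.* pow p k

pow-nonNeg : ∀ p k → 0ℚ ℚ.≤ p → 0ℚ ℚ.≤ pow p k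
pow-nonNeg p zero    _   = ℕ→ℚ-nonNeg 1
pow-nonNeg p (suc k) 0≤p = *-nonNeg 0≤p (pow-nonNeg p k 0≤p)

pow-distrib-* : ∀ p q k → pow (p ℚ.* q) k ≡ pow p k ℚ.* pow q k
pow-distrib-* p q zero    = refl
pow-distrib-* p q (suc k) = trans (cong (p ℚ.* q ℚ.*_) (pow-distrib-* p q k))
  (solve 4 (λ p q x y → (p :* q) :* (x :* y) := (p :* x) :* (q :* y)) refl p q (pow p k) (pow q k))
  where open +-*-Solver

pow-ℕ→ℚ : ∀ d k → pow (ℕ→ℚ d) k ≡ ℕ→ℚ (d ^ k)
pow-ℕ→ℚ d zero    = refl
pow-ℕ→ℚ d (suc k) = trans (cong (ℕ→ℚ d ℚ.*_) (pow-ℕ→ℚ d k)) (sym (ℕ→ℚ-* d (d ^ k)))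

*-sum-≤ : ∀ (g : A → ℕ) xs a q → (∀ {x} → x ∈ xs → a ℚ.* ℕ→ℚ (g x) ℚ.≤ q) →
          a ℚ.* ℕ→ℚ (sum (map g xs)) ℚ.≤ ℕ→ℚ (length xs) ℚ.* q
*-sum-≤ g []       a q _    = ℚₚ.≤-reflexive (trans (ℚₚ.*-zeroʳ a) (sym (ℚₚ.*-zeroˡ q)))
*-sum-≤ g (x ∷ xs) a q ag≤q = subst₂ ℚ._≤_ (sym distrib) (sym unfold)
  (ℚₚ.+-mono-≤ (ag≤q (here refl)) (*-sum-≤ g xs a q (ag≤q ∘ there)))
  where
  open +-*-Solver
  distrib : a ℚ.* ℕ→ℚ (g x + sum (map g xs)) ≡ a ℚ.* ℕ→ℚ (g x) ℚ.+ a ℚ.* ℕ→ℚ (sum (map g xs))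
  distrib = trans (cong (a ℚ.*_) (ℕ→ℚ-+ (g x) _)) (ℚₚ.*-distribˡ-+ a _ _)
  unfold : ℕ→ℚ (suc (length xs)) ℚ.* q ≡ q ℚ.+ ℕ→ℚ (length xs) ℚ.* q
  unfold = trans (cong (ℚ._* q) (ℕ→ℚ-+ 1 (length xs)))
    (solve 2 (λ l q → (con 1ℚ :+ l) :* q := q :+ l :* q) refl (ℕ→ℚ (length xs)) q)

weightedGeometricSum : ℚ → ℕ → ℚ
weightedGeometricSum r zero    = 0ℚ
weightedGeometricSum r (suc T) = weightedGeometricSum r T ℚ.+ ℕ→ℚ (suc T) ℚ.* pow r T

weightedGeometricSum-closed : ∀ r T → (1ℚ ℚ.- r) ℚ.* (1ℚ ℚ.- r) ℚ.* weightedGeometricSum r T ≡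
                                      1ℚ ℚ.- pow r T ℚ.* (ℕ→ℚ T ℚ.+ 1ℚ ℚ.- ℕ→ℚ T ℚ.* r)
weightedGeometricSum-closed r zero =
  solve 1 (λ r → (con 1ℚ :- r) :* (con 1ℚ :- r) :* con 0ℚ := con 1ℚ :- con 1ℚ :* (con 0ℚ :+ con 1ℚ :- con 0ℚ :* r)) refl r
  where open +-*-Solver
weightedGeometricSum-closed r (suc T) = begin
  s ℚ.* s ℚ.* (S ℚ.+ ℕ→ℚ (suc T) ℚ.* y)     ≡⟨ cong (λ z → s ℚ.* s ℚ.* (S ℚ.+ z ℚ.* y)) (ℕ→ℚ-+ 1 T) ⟩
  s ℚ.* s ℚ.* (S ℚ.+ (1ℚ ℚ.+ x) ℚ.* y)      ≡⟨ solve 4 (λ s S x y → s :* s :* (S :+ (con 1ℚ :+ x) :* y) :=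
                                                                   s :* s :* S :+ s :* s :* (con 1ℚ :+ x) :* y) refl s S x y ⟩
  s ℚ.* s ℚ.* S ℚ.+ s ℚ.* s ℚ.* (1ℚ ℚ.+ x) ℚ.* y
                                              ≡⟨ cong (ℚ._+ s ℚ.* s ℚ.* (1ℚ ℚ.+ x) ℚ.* y) (weightedGeometricSum-closed r T) ⟩
  1ℚ ℚ.- y ℚ.* (x ℚ.+ 1ℚ ℚ.- x ℚ.* r) ℚ.+ s ℚ.* s ℚ.* (1ℚ ℚ.+ x) ℚ.* y
                                              ≡⟨ solve 3 (λ r x y → con 1ℚ :- y :* (x :+ con 1ℚ :- x :* r)
                                                                       :+ (con 1ℚ :- r) :* (con 1ℚ :- r) :* (con 1ℚ :+ x) :* y :=
                                                                     con 1ℚ :- (r :* y) :* ((con 1ℚ :+ x) :+ con 1ℚ :- (con 1ℚ :+ x) :* r))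
                                                       refl r x y ⟩
  1ℚ ℚ.- r ℚ.* y ℚ.* ((1ℚ ℚ.+ x) ℚ.+ 1ℚ ℚ.- (1ℚ ℚ.+ x) ℚ.* r)
                                              ≡⟨ cong (λ z → 1ℚ ℚ.- r ℚ.* y ℚ.* (z ℚ.+ 1ℚ ℚ.- z ℚ.* r)) (sym (ℕ→ℚ-+ 1 T)) ⟩
  1ℚ ℚ.- pow r (suc T) ℚ.* (ℕ→ℚ (suc T) ℚ.+ 1ℚ ℚ.- ℕ→ℚ (suc T) ℚ.* r) ∎
  where
  open +-*-Solver
  open ≡-Reasoning
  s S x y : ℚ
  s = 1ℚ ℚ.- r
  S = weightedGeometricSum r T
  x = ℕ→ℚ T
  y = pow r T

weightedGeometricSum-≤ : ∀ r T → 0ℚ ℚ.≤ r → 0ℚ ℚ.< 1ℚ ℚ.- r →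
                         (1ℚ ℚ.- r) ℚ.* (1ℚ ℚ.- r) ℚ.* weightedGeometricSum r T ℚ.≤ 1ℚ
weightedGeometricSum-≤ r T 0≤r 0<1-r = subst (ℚ._≤ 1ℚ) (sym (weightedGeometricSum-closed r T))
  (1-nonNeg≤1 (*-nonNeg (pow-nonNeg r T 0≤r) tail-nonNeg))
  where
  open +-*-Solver
  1-nonNeg≤1 : ∀ {z} → 0ℚ ℚ.≤ z → 1ℚ ℚ.- z ℚ.≤ 1ℚ
  1-nonNeg≤1 {z} 0≤z = subst (1ℚ ℚ.- z ℚ.≤_) (ℚₚ.+-identityʳ 1ℚ) (ℚₚ.+-monoʳ-≤ 1ℚ (ℚₚ.neg-antimono-≤ 0≤z))
  tail-nonNeg : 0ℚ ℚ.≤ ℕ→ℚ T ℚ.+ 1ℚ ℚ.- ℕ→ℚ T ℚ.* r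
  tail-nonNeg = subst (0ℚ ℚ.≤_) (solve 2 (λ x r → con 1ℚ :+ x :* (con 1ℚ :- r) := x :+ con 1ℚ :- x :* r) refl (ℕ→ℚ T) r)
    (ℚₚ.+-mono-≤ (ℕ→ℚ-nonNeg 1) (*-nonNeg (ℕ→ℚ-nonNeg T) (ℚₚ.<⇒≤ 0<1-r)))

Δ/[1-r]² : ℕ → (r : ℚ) → 0ℚ ℚ.< 1ℚ ℚ.- r → ℚ
Δ/[1-r]² Δ r 0<1-r = ℕ→ℚ Δ ℚ.* (ℚ.1/ (1ℚ ℚ.- r)) {{ℚ.>-nonZero 0<1-r}} ℚ.* (ℚ.1/ (1ℚ ℚ.- r)) {{ℚ.>-nonZero 0<1-r}}

*-weightedGeometricSum-≤ : ∀ Δ r T → 0ℚ ℚ.≤ r → (0<1-r : 0ℚ ℚ.< 1ℚ ℚ.- r) →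
                           ℕ→ℚ Δ ℚ.* weightedGeometricSum r T ℚ.≤ Δ/[1-r]² Δ r 0<1-r
*-weightedGeometricSum-≤ Δ r T 0≤r 0<1-r = subst₂ ℚ._≤_ (sym lhs) (sym rhs)
  (*-monoˡ-≤-nonNeg (ℕ→ℚ Δ) (ℕ→ℚ-nonNeg Δ) (*-monoˡ-≤-nonNeg (u ℚ.* u) 0≤u² (weightedGeometricSum-≤ r T 0≤r 0<1-r)))
  where
  open +-*-Solver
  s u S : ℚ
  s = 1ℚ ℚ.- r
  u = (ℚ.1/ s) {{ℚ.>-nonZero 0<1-r}}
  S = weightedGeometricSum r T
  0≤u² : 0ℚ ℚ.≤ u ℚ.* u
  0≤u² = *-nonNeg (ℚₚ.<⇒≤ (1/-pos s 0<1-r)) (ℚₚ.<⇒≤ (1/-pos s 0<1-r))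
  us≡1 : (u ℚ.* s) ℚ.* (u ℚ.* s) ≡ 1ℚ
  us≡1 = cong₂ ℚ._*_ (ℚₚ.*-inverseˡ s {{ℚ.>-nonZero 0<1-r}}) (ℚₚ.*-inverseˡ s {{ℚ.>-nonZero 0<1-r}})
  lhs : ℕ→ℚ Δ ℚ.* S ≡ ℕ→ℚ Δ ℚ.* (u ℚ.* u ℚ.* (s ℚ.* s ℚ.* S))
  lhs = trans (cong (ℕ→ℚ Δ ℚ.*_) (sym (ℚₚ.*-identityˡ S))) (trans (cong (λ z → ℕ→ℚ Δ ℚ.* (z ℚ.* S)) (sym us≡1))
    (solve 4 (λ d S u s → d :* ((u :* s) :* (u :* s) :* S) := d :* (u :* u :* (s :* s :* S))) refl (ℕ→ℚ Δ) S u s))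
  rhs : ℕ→ℚ Δ ℚ.* u ℚ.* u ≡ ℕ→ℚ Δ ℚ.* (u ℚ.* u ℚ.* 1ℚ)
  rhs = solve 2 (λ d u → d :* u :* u := d :* (u :* u :* con 1ℚ)) refl (ℕ→ℚ Δ) u

p<1⇒0<1-p : ∀ {p} → p ℚ.< 1ℚ → 0ℚ ℚ.< 1ℚ ℚ.- p
p<1⇒0<1-p {p} p<1 = subst (ℚ._< 1ℚ ℚ.- p) (ℚₚ.+-inverseʳ p) (ℚₚ.+-monoˡ-< (ℚ.- p) p<1)

VertexSet : ℕ → Set
VertexSet m = Fin m → Bool

_∈ᵛ_ : Fin m → VertexSet m → Set
z ∈ᵛ U = T (U z)

_∉ᵛ_ : Fin m → VertexSet m → Set
z ∉ᵛ U = T (not (U z))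

_∈?ᶠ_ : (z : Fin m) (ws : List (Fin m)) → Dec (z ∈ ws)
z ∈?ᶠ ws = Any.any? (z Fin.≟_) ws

_─_ : VertexSet m → List (Fin m) → VertexSet m
(U ─ ws) z = U z ∧ not (does (z ∈?ᶠ ws))

∈ᵛ∧∉ᵛ⇒⊥ : ∀ (U : VertexSet m) z → z ∈ᵛ U → z ∉ᵛ U → ⊥
∈ᵛ∧∉ᵛ⇒⊥ U z z∈U z∉U with U z
... | true = z∉U

module _ (U : VertexSet m) (ws : List (Fin m)) (z : Fin m) where

  ∈ᵛ-─⁻ : z ∈ᵛ (U ─ ws) → z ∈ᵛ U × z ∉ ws
  ∈ᵛ-─⁻ z∈ with U z | z ∈?ᶠ ws
  ... | true | no z∉ws = tt , z∉ws

  ∈ᵛ-─⁺ : z ∈ᵛ U → z ∉ ws → z ∈ᵛ (U ─ ws)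
  ∈ᵛ-─⁺ z∈U z∉ws with U z | z ∈?ᶠ ws
  ... | true | no _       = tt
  ... | true | yes z∈ws = z∉ws z∈ws

  ∉ᵛ-─⁻ : z ∉ᵛ (U ─ ws) → z ∉ᵛ U ⊎ z ∈ ws
  ∉ᵛ-─⁻ z∉ with U z | z ∈?ᶠ ws
  ... | false | _         = inj₁ tt
  ... | true  | yes z∈ws = inj₂ z∈ws

  ∉ᵛ-─⁺ˡ : z ∉ᵛ U → z ∉ᵛ (U ─ ws)
  ∉ᵛ-─⁺ˡ z∉U with U z
  ... | false = tt

  ∉ᵛ-─⁺ʳ : z ∈ ws → z ∉ᵛ (U ─ ws)
  ∉ᵛ-─⁺ʳ z∈ws with U z | z ∈?ᶠ ws
  ... | false | _        = tt
  ... | true  | yes _    = tt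
  ... | true  | no z∉ws = z∉ws z∈ws

─-cong : ∀ (U : VertexSet m) {ws ws′} → (∀ {z} → z ∈ ws → z ∈ ws′) → (∀ {z} → z ∈ ws′ → z ∈ ws) →
         U ─ ws ≗ U ─ ws′
─-cong U {ws} {ws′} ws⊆ws′ ws′⊆ws z with U z | z ∈?ᶠ ws | z ∈?ᶠ ws′
... | false | _        | _         = refl
... | true  | yes _    | yes _     = refl
... | true  | no _     | no _      = refl
... | true  | yes z∈ | no z∉     = ⊥-elim (z∉ (ws⊆ws′ z∈))
... | true  | no z∉  | yes z∈    = ⊥-elim (z∉ (ws′⊆ws z∈))

─-─ : ∀ (U : VertexSet m) ws ws′ → (U ─ ws) ─ ws′ ≗ U ─ (ws ++ ws′)
─-─ U ws ws′ z with U z | z ∈?ᶠ ws | z ∈?ᶠ ws′ | z ∈?ᶠ (ws ++ ws′)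
... | false | _        | _         | _          = refl
... | true  | yes _    | _         | yes _      = refl
... | true  | no _     | yes _     | yes _      = refl
... | true  | no _     | no _      | no _       = refl
... | true  | yes z∈ | _         | no z∉      = ⊥-elim (z∉ (∈-++⁺ˡ z∈))
... | true  | no _     | yes z∈  | no z∉      = ⊥-elim (z∉ (∈-++⁺ʳ ws z∈))
... | true  | no z∉  | no z∉′   | yes z∈     = ⊥-elim ([ z∉ , z∉′ ]′ (∈-++⁻ ws z∈))

─-[] : ∀ (U : VertexSet m) → U ─ [] ≗ U
─-[] U z with U z
... | true  = refl
... | false = refl

size : VertexSet m → ℕ
size {m} U = length (filter (λ z → T? (U z)) (allFin m))

size-mono : ∀ {W U : VertexSet m} → (∀ {z} → z ∈ᵛ W → z ∈ᵛ U) → size W ≤ size U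
size-mono {m} {W} {U} W⊆U = Unique⇒length-mono-⊆ (Uniqueₚ.filter⁺ (λ z → T? (W z)) (Uniqueₚ.allFin⁺ m))
  λ {z} z∈ → ∈-filter⁺ (λ z → T? (U z)) (∈-allFin z) (W⊆U (proj₂ (∈-filter⁻ (λ z → T? (W z)) {xs = allFin m} z∈)))

size-─ : ∀ (U : VertexSet m) ws → size (U ─ ws) ≤ size U
size-─ U ws = size-mono λ {z} → proj₁ ∘ ∈ᵛ-─⁻ U ws z

size-─-< : ∀ (U : VertexSet m) v → v ∈ᵛ U → size (U ─ [ v ]) < size U
size-─-< {m} U v v∈U = Unique⇒length-mono-⊆ (v∉ ∷ Uniqueₚ.filter⁺ (λ z → T? ((U ─ [ v ]) z)) (Uniqueₚ.allFin⁺ m)) ⊆U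
  where
  U-v : List (Fin m)
  U-v = filter (λ z → T? ((U ─ [ v ]) z)) (allFin m)
  ∈U-v⁻ : ∀ {z} → z ∈ U-v → z ∈ᵛ U × z ∉ [ v ]
  ∈U-v⁻ {z} z∈ = ∈ᵛ-─⁻ U [ v ] z (proj₂ (∈-filter⁻ (λ z → T? ((U ─ [ v ]) z)) {xs = allFin m} z∈))
  v∉ : All (v ≢_) U-v
  v∉ = All.tabulate λ z∈ v≡z → proj₂ (∈U-v⁻ z∈) (here (sym v≡z))
  ⊆U : ∀ {z} → z ∈ v ∷ U-v → z ∈ filter (λ z → T? (U z)) (allFin m)
  ⊆U (here refl) = ∈-filter⁺ (λ z → T? (U z)) (∈-allFin v) v∈U
  ⊆U {z} (there z∈) = ∈-filter⁺ (λ z → T? (U z)) (∈-allFin z) (proj₁ (∈U-v⁻ z∈))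

listsUpTo : ℕ → List (List (Fin m))
listsUpTo         zero    = [ [] ]
listsUpTo {m = m} (suc k) = [] ∷ concatMap (λ z → map (z ∷_) (listsUpTo k)) (allFin m)

∈-listsUpTo : ∀ k (p : List (Fin m)) → length p ≤ k → p ∈ listsUpTo k
∈-listsUpTo zero    []      _         = here refl
∈-listsUpTo (suc k) []      _         = here refl
∈-listsUpTo (suc k) (z ∷ p) (s≤s |p|≤k) = there (∈-concatMap⁺ (λ w → map (w ∷_) (listsUpTo k))
  (lose (∈-allFin z) (∈-map⁺ (z ∷_) (∈-listsUpTo k p |p|≤k))))

splits : List A → List (List A × List A)
splits []       = [ [] , [] ]
splits (x ∷ xs) = ([] , x ∷ xs) ∷ map (λ (as , bs) → x ∷ as , bs) (splits xs)

∈-splits : ∀ (as bs : List A) → (as , bs) ∈ splits (as ++ bs)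
∈-splits []       []       = here refl
∈-splits []       (b ∷ bs) = here refl
∈-splits (a ∷ as) bs       = there (∈-map⁺ (λ (as , bs) → a ∷ as , bs) (∈-splits as bs))

splits-sound : ∀ (p : List A) {as bs} → (as , bs) ∈ splits p → p ≡ as ++ bs
splits-sound []      (here refl) = refl
splits-sound (x ∷ p) (here refl) = refl
splits-sound (x ∷ p) (there ∈map) with ∈-map⁻ (λ (as , bs) → x ∷ as , bs) ∈map
... | _ , ∈splits , refl = cong (x ∷_) (splits-sound p ∈splits)

vectors : ∀ {k} → (Fin k → List A) → List (Vec A k)
vectors {k = zero}  f = [ Vec.[] ]
vectors {k = suc k} f = concatMap (λ a → map (a Vec.∷_) (vectors (f ∘ Fin.suc))) (f Fin.zero)

∈-vectors : ∀ {k} (f : Fin k → List A) (φ : Vec A k) → (∀ i → lookup φ i ∈ f i) → φ ∈ vectors f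
∈-vectors {k = zero}  f Vec.[]        _      = here refl
∈-vectors {k = suc k} f (a Vec.∷ φ) φ∈f =
  ∈-concatMap⁺ (λ a → map (a Vec.∷_) (vectors (f ∘ Fin.suc)))
    (lose (φ∈f Fin.zero) (∈-map⁺ (a Vec.∷_) (∈-vectors (f ∘ Fin.suc) φ (φ∈f ∘ Fin.suc))))

vectors-unique : ∀ {k} (f : Fin k → List A) → (∀ i → Unique (f i)) → Unique (vectors f)
vectors-unique {k = zero}  f _  = [] ∷ []
vectors-unique {k = suc k} f !f =
  Unique-concatMap (λ a → map (a Vec.∷_) (vectors (f ∘ Fin.suc))) (!f Fin.zero)
    (λ _ → Uniqueₚ.map⁺ (proj₂ ∘ Vecₚ.∷-injective) (vectors-unique (f ∘ Fin.suc) (!f ∘ Fin.suc)))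
    (λ _ _ → same-head)
  where
  same-head : ∀ {a b φ} → φ ∈ map (a Vec.∷_) (vectors (f ∘ Fin.suc)) → φ ∈ map (b Vec.∷_) (vectors (f ∘ Fin.suc)) → a ≡ b
  same-head φ∈a φ∈b with ∈-map⁻ _ φ∈a | ∈-map⁻ _ φ∈b
  ... | _ , _ , refl | _ , _ , eq = proj₁ (Vecₚ.∷-injective eq)

repetitivelyColoured? : ∀ (φ : Colouring m) p → Dec (RepetitivelyColoured φ p)
repetitivelyColoured? φ p = map′ from to (Any.any? halves? (splits p))
  where
  RepetitiveSplit : List (Fin _) × List (Fin _) → Set
  RepetitiveSplit (as , bs) = (as ≢ []) × (length as ≡ length bs) × (map (lookup φ) as ≡ map (lookup φ) bs)
  halves? : ∀ s → Dec (RepetitiveSplit s)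
  halves? ([]     , bs) = no λ (as≢[] , _) → as≢[] refl
  halves? (a ∷ as , bs) = yes (λ ()) ×-dec (length (a ∷ as) ℕ.≟ length bs)
                                      ×-dec Listₚ.≡-dec ℕ._≟_ (map (lookup φ) (a ∷ as)) (map (lookup φ) bs)
  from : Any RepetitiveSplit (splits p) → RepetitivelyColoured φ p
  from any with find any
  ... | (as , bs) , ∈splits , rep = as , bs , splits-sound p ∈splits , rep
  to : RepetitivelyColoured φ p → Any RepetitiveSplit (splits p)
  to (as , bs , refl , rep) = lose (∈-splits as bs) rep

module _ (G : Graph m) where

  isPath? : ∀ p → Dec (IsPath G p)
  isPath? p = AllPairs.allPairs? (λ x y → ¬? (x Fin.≟ y)) p ×-dec Linked.linked? (λ x y → T? (adj G x y)) p

  IsPath⇒length≤ : ∀ {p} → IsPath G p → length p ≤ m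
  IsPath⇒length≤ {p} (!p , _) = ℕₚ.≤-trans (Unique⇒length-mono-⊆ !p λ {x} _ → ∈-allFin x)
                                          (ℕₚ.≤-reflexive (Listₚ.length-tabulate Function.id))

  RepetitivePathIn : VertexSet m → Colouring m → List (Fin m) → Set
  RepetitivePathIn U φ p = IsPath G p × All (_∈ᵛ U) p × RepetitivelyColoured φ p

  repetitivePathIn? : ∀ U φ → Dec (∃ (RepetitivePathIn U φ))
  repetitivePathIn? U φ = map′ from to (Any.any? repPath? (listsUpTo m))
    where
    repPath? : ∀ p → Dec (RepetitivePathIn U φ p)
    repPath? p = isPath? p ×-dec All.all? (λ z → T? (U z)) p ×-dec repetitivelyColoured? φ p
    from : Any (RepetitivePathIn U φ) (listsUpTo m) → ∃ (RepetitivePathIn U φ)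
    from any with find any
    ... | p , _ , repPath = p , repPath
    to : ∃ (RepetitivePathIn U φ) → Any (RepetitivePathIn U φ) (listsUpTo m)
    to (p , repPath@(path , _)) = lose (∈-listsUpTo m p (IsPath⇒length≤ path)) repPath

module _ (G : Graph m) (L : ListAssignment m) where

  -- A colouring of the induced subgraph G[U] is encoded as a colouring of G that is 0 outside U.
  record NonrepLColouringOf (U : VertexSet m) (φ : Colouring m) : Set where
    field
      in-lists     : ∀ z → z ∈ᵛ U → lookup φ z ∈ L z
      zero-outside : ∀ z → z ∉ᵛ U → lookup φ z ≡ 0
      nonrep       : ¬ ∃ (RepetitivePathIn G U φ)

  nonrepLColouringOf? : ∀ U φ → Dec (NonrepLColouringOf U φ)
  nonrepLColouringOf? U φ = map′ (λ (l , o , n) → record { in-lists = l ; zero-outside = o ; nonrep = n })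
                                 (λ c → let open NonrepLColouringOf c in in-lists , zero-outside , nonrep)
    (Finₚ.all? (λ z → T? (U z) →-dec (lookup φ z ∈? L z))
     ×-dec Finₚ.all? (λ z → T? (not (U z)) →-dec (lookup φ z ℕ.≟ 0))
     ×-dec ¬? (repetitivePathIn? G U φ))
    where open import Data.List.Membership.DecPropositional ℕ._≟_ using (_∈?_)

  NonrepLColouringOf-cong : ∀ {U U′} → U ≗ U′ → ∀ φ → NonrepLColouringOf U φ → NonrepLColouringOf U′ φ
  NonrepLColouringOf-cong U≗U′ φ c = record
    { in-lists     = λ z → in-lists z ∘ subst T (sym (U≗U′ z))
    ; zero-outside = λ z → zero-outside z ∘ subst (T ∘ not) (sym (U≗U′ z))
    ; nonrep       = λ (p , path , inU′ , rep) → nonrep (p , path , All.map (λ {z} → subst T (sym (U≗U′ z))) inU′ , rep)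
    }
    where open NonrepLColouringOf c

module Enumeration (G : Graph m) (L : ListAssignment m) (L-unique : ∀ z → Unique (L z)) where

  palette : VertexSet m → Fin m → List ℕ
  palette U z = if U z then L z else [ 0 ]

  enumerate : VertexSet m → List (Colouring m)
  enumerate U = filter (nonrepLColouringOf? G L U) (vectors (palette U))

  enumerate-correct : ∀ U → Enumerates (NonrepLColouringOf G L U) (enumerate U)
  enumerate-correct U = record
    { unique   = Uniqueₚ.filter⁺ (nonrepLColouringOf? G L U) (vectors-unique (palette U) palette-unique)
    ; sound    = Allₚ.all-filter (nonrepLColouringOf? G L U) (vectors (palette U))
    ; complete = λ φ c → ∈-filter⁺ (nonrepLColouringOf? G L U) (∈-vectors (palette U) φ (in-palette c)) c
    }
    where
    palette-unique : ∀ z → Unique (palette U z)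
    palette-unique z with U z
    ... | true  = L-unique z
    ... | false = [] ∷ []
    in-palette : ∀ {φ} → NonrepLColouringOf G L U φ → ∀ z → lookup φ z ∈ palette U z
    in-palette c z with U z in Uz
    ... | true  = NonrepLColouringOf.in-lists c z (subst T (sym Uz) tt)
    ... | false = here (NonrepLColouringOf.zero-outside c z (subst (T ∘ not) (sym Uz) tt))

  Π : VertexSet m → ℕ
  Π U = length (enumerate U)

  Π-cong : ∀ {U U′} → U ≗ U′ → Π U ≡ Π U′
  Π-cong {U} {U′} U≗U′ = Enumerates-length-cong (enumerate-correct U) (enumerate-correct U′)
    (NonrepLColouringOf-cong G L U≗U′) (NonrepLColouringOf-cong G L (sym ∘ U≗U′))

erase : List (Fin m) → Colouring m → Colouring m
erase S φ = Vec.tabulate λ z → if does (z ∈?ᶠ S) then 0 else lookup φ z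

module _ (S : List (Fin m)) (φ : Colouring m) {z : Fin m} where

  lookup-erase-∉ : z ∉ S → lookup (erase S φ) z ≡ lookup φ z
  lookup-erase-∉ z∉S rewrite Vecₚ.lookup∘tabulate (λ z → if does (z ∈?ᶠ S) then 0 else lookup φ z) z
    with z ∈?ᶠ S
  ... | yes z∈S = ⊥-elim (z∉S z∈S)
  ... | no _    = refl

  lookup-erase-∈ : z ∈ S → lookup (erase S φ) z ≡ 0
  lookup-erase-∈ z∈S rewrite Vecₚ.lookup∘tabulate (λ z → if does (z ∈?ᶠ S) then 0 else lookup φ z) z
    with z ∈?ᶠ S
  ... | yes _   = refl
  ... | no z∉S = ⊥-elim (z∉S z∈S)

partner : Fin m → List (Fin m) → List (Fin m) → Fin m
partner z (a ∷ S) (b ∷ O) = if does (z Fin.≟ a) then b else partner z S O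
partner z _       _       = z

partner-∈ : ∀ (φ : Colouring m) {z} S O → map (lookup φ) S ≡ map (lookup φ) O → z ∈ S →
            partner z S O ∈ O × lookup φ (partner z S O) ≡ lookup φ z
partner-∈ φ {z} (a ∷ S) (b ∷ O) φS≡φO z∈ with z Fin.≟ a | z∈
... | yes refl | _          = here refl , sym (Listₚ.∷-injectiveˡ φS≡φO)
... | no z≢a   | here z≡a   = ⊥-elim (z≢a z≡a)
... | no _     | there z∈S = map₁ there (partner-∈ φ S O (Listₚ.∷-injectiveʳ φS≡φO) z∈S)

partner-∉ : ∀ {z : Fin m} S O → z ∉ S → partner z S O ≡ z
partner-∉     []      O       _    = refl
partner-∉     (a ∷ S) []      _    = refl
partner-∉ {z = z} (a ∷ S) (b ∷ O) z∉ with z Fin.≟ a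
... | yes z≡a = ⊥-elim (z∉ (here z≡a))
... | no _    = partner-∉ S O (z∉ ∘ there)

fill : List (Fin m) → List (Fin m) → Colouring m → Colouring m
fill S O φ = Vec.tabulate λ z → lookup φ (partner z S O)

fill-erase : ∀ S O (φ : Colouring m) → map (lookup φ) S ≡ map (lookup φ) O → (∀ {z} → z ∈ O → z ∉ S) →
             fill S O (erase S φ) ≡ φ
fill-erase S O φ φS≡φO O∩S=∅ = trans (Vecₚ.tabulate-cong pointwise) (Vecₚ.tabulate∘lookup φ)
  where
  pointwise : ∀ z → lookup (erase S φ) (partner z S O) ≡ lookup φ z
  pointwise z with z ∈?ᶠ S
  ... | yes z∈S = let z′∈O , φz′≡φz = partner-∈ φ S O φS≡φO z∈S
                  in trans (lookup-erase-∉ S φ (O∩S=∅ z′∈O)) φz′≡φz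
  ... | no z∉S rewrite partner-∉ S O z∉S = lookup-erase-∉ S φ z∉S

RepetitivelyColoured-cong : ∀ {φ ψ : Colouring m} p → (∀ {z} → z ∈ p → lookup φ z ≡ lookup ψ z) →
                            RepetitivelyColoured φ p → RepetitivelyColoured ψ p
RepetitivelyColoured-cong p φ≡ψ (as , bs , refl , as≢[] , |as|≡|bs| , φas≡φbs) =
  as , bs , refl , as≢[] , |as|≡|bs| ,
  trans (sym (Listₚ.map-cong-local (All.tabulate (φ≡ψ ∘ ∈-++⁺ˡ))))
        (trans φas≡φbs (Listₚ.map-cong-local (All.tabulate (φ≡ψ ∘ ∈-++⁺ʳ as))))

Adj-sym : ∀ (G : Graph m) {x y} → Adj G x y → Adj G y x
Adj-sym G {x} {y} = subst T (Graph.sym G x y)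

IsPath-reverse : ∀ {G : Graph m} {p} → IsPath G p → IsPath G (reverse p)
IsPath-reverse {G = G} (!p , linked) = Unique-reverse !p , Linked-reverse (Adj-sym G) linked

reverse-halves : ∀ {G : Graph m} {P : Fin m → Set} {f : Fin m → ℕ} as bs →
                 IsPath G (as ++ bs) → All P (as ++ bs) → length as ≡ length bs → map f as ≡ map f bs →
                 IsPath G (reverse bs ++ reverse as) × All P (reverse bs ++ reverse as) ×
                 length (reverse bs) ≡ length (reverse as) × map f (reverse bs) ≡ map f (reverse as)
reverse-halves {G = G} {f = f} as bs path inside |as|≡|bs| fas≡fbs =
  subst (IsPath G) (Listₚ.reverse-++ as bs) (IsPath-reverse {G = G} path) ,
  All.tabulate (λ {z} z∈ → All.lookup inside (Anyₚ.reverse⁻ (subst (z ∈_) (sym (Listₚ.reverse-++ as bs)) z∈))) ,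
  trans (Listₚ.length-reverse bs) (trans (sym |as|≡|bs|) (sym (Listₚ.length-reverse as))) ,
  trans (Listₚ.reverse-map f bs) (trans (cong reverse (sym fas≡fbs)) (sym (Listₚ.reverse-map f as)))

HalvesCoveredBy : Graph m → VertexSet m → Fin m → List (List (Fin m) × List (Fin m)) → Set
HalvesCoveredBy G U v Cs = ∀ as bs → IsPath G (as ++ bs) → All (_∈ᵛ U) (as ++ bs) → v ∈ as →
                           length as ≡ length bs → (as , bs) ∈ Cs

module Extension (G : Graph m) (L : ListAssignment m) (L-unique : ∀ z → Unique (L z))
               {U : VertexSet m} {v : Fin m} (v∈U : v ∈ᵛ U)
               (Cs : List (List (Fin m) × List (Fin m))) (covered : HalvesCoveredBy G U v Cs) where

  open Enumeration G L L-unique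

  Good : VertexSet m → Colouring m → Set
  Good = NonrepLColouringOf G L

  extensions : List (Colouring m)
  extensions = concatMap (λ ψ → map (ψ Vec.[ v ]≔_) (L v)) (enumerate (U ─ [ v ]))

  reconstructions : List (Colouring m)
  reconstructions = concatMap (λ (S , O) → map (fill S O) (enumerate (U ─ S))) Cs

  module _ {ψ : Colouring m} (ψ-good : Good (U ─ [ v ]) ψ) {a : ℕ} (a∈Lv : a ∈ L v) where

    open NonrepLColouringOf ψ-good

    φ : Colouring m
    φ = ψ Vec.[ v ]≔ a

    φ≡ψ : ∀ {z} → z ≢ v → lookup φ z ≡ lookup ψ z
    φ≡ψ z≢v = Vecₚ.lookup∘update′ z≢v ψ a

    φ-in-lists : ∀ z → z ∈ᵛ U → lookup φ z ∈ L z
    φ-in-lists z z∈U with z Fin.≟ v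
    ... | yes refl = subst (_∈ L v) (sym (Vecₚ.lookup∘update v ψ a)) a∈Lv
    ... | no z≢v   = subst (_∈ L z) (sym (φ≡ψ z≢v)) (in-lists z (∈ᵛ-─⁺ U [ v ] z z∈U λ { (here z≡v) → z≢v z≡v }))

    φ-zero-outside : ∀ z → z ∉ᵛ U → lookup φ z ≡ 0
    φ-zero-outside z z∉U with z Fin.≟ v
    ... | yes refl = ⊥-elim (∈ᵛ∧∉ᵛ⇒⊥ U v v∈U z∉U)
    ... | no z≢v   = trans (φ≡ψ z≢v) (zero-outside z (∉ᵛ-─⁺ˡ U [ v ] z z∉U))

    erase-good : ∀ {S} → v ∈ S → Good (U ─ S) (erase S φ)
    erase-good {S} v∈S = record
      { in-lists     = λ z z∈ → let z∈U , z∉S = ∈ᵛ-─⁻ U S z z∈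
                                in subst (_∈ L z) (sym (lookup-erase-∉ S φ z∉S)) (φ-in-lists z z∈U)
      ; zero-outside = λ z z∉ → [ (λ z∉U → erase-zero z (φ-zero-outside z z∉U)) , lookup-erase-∈ S φ ]′ (∉ᵛ-─⁻ U S z z∉)
      ; nonrep       = λ (q , path , inside , rep) → nonrep (q , path , All.map inside-U-v inside ,
                         RepetitivelyColoured-cong {φ = erase S φ} {ψ} q (λ {z} z∈q → erased≡ψ (All.lookup inside z∈q)) rep)
      }
      where
      erase-zero : ∀ z → lookup φ z ≡ 0 → lookup (erase S φ) z ≡ 0
      erase-zero z φz≡0 with z ∈?ᶠ S
      ... | yes z∈S = lookup-erase-∈ S φ z∈S
      ... | no z∉S  = trans (lookup-erase-∉ S φ z∉S) φz≡0
      ≢v : ∀ {z} → z ∈ᵛ (U ─ S) → z ≢ v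
      ≢v {z} z∈ refl = proj₂ (∈ᵛ-─⁻ U S z z∈) v∈S
      inside-U-v : ∀ {z} → z ∈ᵛ (U ─ S) → z ∈ᵛ (U ─ [ v ])
      inside-U-v {z} z∈ = ∈ᵛ-─⁺ U [ v ] z (proj₁ (∈ᵛ-─⁻ U S z z∈)) λ { (here z≡v) → ≢v z∈ z≡v }
      erased≡ψ : ∀ {z} → z ∈ᵛ (U ─ S) → lookup (erase S φ) z ≡ lookup ψ z
      erased≡ψ {z} z∈ = trans (lookup-erase-∉ S φ (proj₂ (∈ᵛ-─⁻ U S z z∈))) (φ≡ψ (≢v z∈))

    reconstructed : ∀ S O → IsPath G (S ++ O) → All (_∈ᵛ U) (S ++ O) → v ∈ S → length S ≡ length O →
                    map (lookup φ) S ≡ map (lookup φ) O → φ ∈ reconstructions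
    reconstructed S O path inside v∈S |S|≡|O| φS≡φO =
      ∈-concatMap⁺ (λ (S , O) → map (fill S O) (enumerate (U ─ S))) (lose (covered S O path inside v∈S |S|≡|O|)
        (subst (_∈ map (fill S O) (enumerate (U ─ S))) (fill-erase S O φ φS≡φO O∩S=∅)
          (∈-map⁺ (fill S O) (Enumerates.complete (enumerate-correct (U ─ S)) _ (erase-good v∈S)))))
      where
      O∩S=∅ : ∀ {z} → z ∈ O → z ∉ S
      O∩S=∅ z∈O z∈S = proj₂ (proj₂ (Unique-++⁻ S (proj₁ path))) z∈S z∈O

    good-or-reconstructed : Good U φ ⊎ φ ∈ reconstructions
    good-or-reconstructed with repetitivePathIn? G U φ
    ... | no ¬rep = inj₁ record { in-lists = φ-in-lists ; zero-outside = φ-zero-outside ; nonrep = ¬rep }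
    ... | yes (_ , path , inside , as , bs , refl , as≢[] , |as|≡|bs| , φas≡φbs) with v ∈?ᶠ (as ++ bs)
    ...   | no v∉p = ⊥-elim (nonrep (as ++ bs , path , All.tabulate inside-U-v ,
                      RepetitivelyColoured-cong {φ = φ} {ψ} (as ++ bs) (λ z∈p → φ≡ψ λ { refl → v∉p z∈p })
                        (as , bs , refl , as≢[] , |as|≡|bs| , φas≡φbs)))
      where
      inside-U-v : ∀ {z} → z ∈ as ++ bs → z ∈ᵛ (U ─ [ v ])
      inside-U-v {z} z∈p = ∈ᵛ-─⁺ U [ v ] z (All.lookup inside z∈p) λ { (here refl) → v∉p z∈p }
    ...   | yes v∈p with ∈-++⁻ as v∈p
    ...     | inj₁ v∈as = inj₂ (reconstructed as bs path inside v∈as |as|≡|bs| φas≡φbs)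
    ...     | inj₂ v∈bs with reverse-halves {G = G} as bs path inside |as|≡|bs| φas≡φbs
    ...       | path′ , inside′ , |bs|≡|as| , φbs≡φas =
      inj₂ (reconstructed (reverse bs) (reverse as) path′ inside′ (Anyₚ.reverse⁺ v∈bs) |bs|≡|as| φbs≡φas)

  extensions-unique : Unique extensions
  extensions-unique = Unique-concatMap (λ ψ → map (ψ Vec.[ v ]≔_) (L v)) (Enumerates.unique (enumerate-correct (U ─ [ v ])))
    (λ {ψ} _ → Uniqueₚ.map⁺ (λ {a} {b} eq → trans (sym (Vecₚ.lookup∘update v ψ a))
                                           (trans (cong (λ φ → lookup φ v) eq) (Vecₚ.lookup∘update v ψ b))) (L-unique v))
    same-restriction
    where
    good : ∀ {ψ} → ψ ∈ enumerate (U ─ [ v ]) → Good (U ─ [ v ]) ψ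
    good = All.lookup (Enumerates.sound (enumerate-correct (U ─ [ v ])))
    reset : ∀ {ψ} a → ψ ∈ enumerate (U ─ [ v ]) → ψ Vec.[ v ]≔ a Vec.[ v ]≔ 0 ≡ ψ
    reset {ψ} a ψ∈ = begin
      ψ Vec.[ v ]≔ a Vec.[ v ]≔ 0  ≡⟨ Vecₚ.[]≔-idempotent ψ v ⟩
      ψ Vec.[ v ]≔ 0               ≡⟨ cong (ψ Vec.[ v ]≔_) ψv≡0 ⟨
      ψ Vec.[ v ]≔ lookup ψ v      ≡⟨ Vecₚ.[]≔-lookup ψ v ⟩
      ψ                            ∎
      where
      open ≡-Reasoning
      ψv≡0 : lookup ψ v ≡ 0
      ψv≡0 = NonrepLColouringOf.zero-outside (good ψ∈) v (∉ᵛ-─⁺ʳ U [ v ] v (here refl))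
    same-restriction : ∀ {ψ ψ′ φ} → ψ ∈ enumerate (U ─ [ v ]) → ψ′ ∈ enumerate (U ─ [ v ]) →
                       φ ∈ map (ψ Vec.[ v ]≔_) (L v) → φ ∈ map (ψ′ Vec.[ v ]≔_) (L v) → ψ ≡ ψ′
    same-restriction ψ∈ ψ′∈ φ∈ φ∈′ with ∈-map⁻ _ φ∈ | ∈-map⁻ _ φ∈′
    ... | a , _ , refl | b , _ , eq = trans (sym (reset a ψ∈)) (trans (cong (Vec._[ v ]≔ 0) eq) (reset b ψ′∈))

  extensions⊆ : ∀ {φ} → φ ∈ extensions → φ ∈ enumerate U ++ reconstructions
  extensions⊆ φ∈ with find (∈-concatMap⁻ (λ ψ → map (ψ Vec.[ v ]≔_) (L v)) {xs = enumerate (U ─ [ v ])} φ∈)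
  ... | ψ , ψ∈ , φ∈ψL with ∈-map⁻ _ φ∈ψL
  ... | a , a∈Lv , refl with good-or-reconstructed (All.lookup (Enumerates.sound (enumerate-correct (U ─ [ v ]))) ψ∈) a∈Lv
  ... | inj₁ good           = ∈-++⁺ˡ (Enumerates.complete (enumerate-correct U) _ good)
  ... | inj₂ reconstructed = ∈-++⁺ʳ (enumerate U) reconstructed

  extension-count : length (L v) * Π (U ─ [ v ]) ≤ Π U + sum (map (λ (S , _) → Π (U ─ S)) Cs)
  extension-count = begin
    length (L v) * Π (U ─ [ v ])              ≡⟨ ℕₚ.*-comm (length (L v)) _ ⟩
    Π (U ─ [ v ]) * length (L v)              ≡⟨ length-concatMap-const _ (enumerate (U ─ [ v ])) _ (λ _ → Listₚ.length-map _ (L v)) ⟨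
    length extensions                         ≤⟨ Unique⇒length-mono-⊆ extensions-unique extensions⊆ ⟩
    length (enumerate U ++ reconstructions)   ≡⟨ Listₚ.length-++ (enumerate U) ⟩
    Π U + length reconstructions              ≡⟨ cong (Π U +_) (length-concatMap _ Cs) ⟩
    Π U + sum (map (length ∘ λ (S , O) → map (fill S O) (enumerate (U ─ S))) Cs)
      ≡⟨ cong (λ n → Π U + sum n) (Listₚ.map-cong (λ (S , O) → Listₚ.length-map (fill S O) (enumerate (U ─ S))) Cs) ⟩
    Π U + sum (map (λ (S , _) → Π (U ─ S)) Cs) ∎
    where open ℕₚ.≤-Reasoning

splitAt-++ : ∀ (as : List A) bs → splitAt (length as) (as ++ bs) ≡ (as , bs)
splitAt-++ []       bs = refl
splitAt-++ (a ∷ as) bs = cong (map₁ (a ∷_)) (splitAt-++ as bs)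

head≡just⇒∈ : ∀ {xs : List A} {x} → Data.List.head xs ≡ just x → x ∈ xs
head≡just⇒∈ {xs = _ ∷ _} refl = here refl

FirstAvoids : Maybe A → List A → Set
FirstAvoids (just p) (w ∷ _) = w ≢ p
FirstAvoids _        _       = ⊤

FirstAvoids-∉ : ∀ {prev : Maybe A} {ws} → (∀ {x} → prev ≡ just x → x ∉ ws) → FirstAvoids prev ws
FirstAvoids-∉ {prev = nothing}              _ = tt
FirstAvoids-∉ {prev = just p} {ws = []}     _ = tt
FirstAvoids-∉ {prev = just p} {ws = w ∷ _} p∉ws refl = p∉ws refl (here refl)

module Walks (G : Graph m) where

  neighbours : Fin m → List (Fin m)
  neighbours z = filter (λ w → T? (adj G z w)) (allFin m)

  ∈-neighbours⁺ : ∀ {z w} → Adj G z w → w ∈ neighbours z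
  ∈-neighbours⁺ {z} {w} zw = ∈-filter⁺ (λ w → T? (adj G z w)) (∈-allFin w) zw

  ∈-neighbours⁻ : ∀ {z w} → w ∈ neighbours z → Adj G z w
  ∈-neighbours⁻ {z} w∈ = proj₂ (∈-filter⁻ (λ w → T? (adj G z w)) {xs = allFin m} w∈)

  neighbours-unique : ∀ z → Unique (neighbours z)
  neighbours-unique z = Uniqueₚ.filter⁺ (λ w → T? (adj G z w)) (Uniqueₚ.allFin⁺ m)

  neighboursAvoiding : Fin m → Maybe (Fin m) → List (Fin m)
  neighboursAvoiding z nothing  = neighbours z
  neighboursAvoiding z (just p) = filter (λ w → ¬? (w Fin.≟ p)) (neighbours z)

  -- Non-backtracking walks: the k vertices visited after z, the first of them avoiding prev.
  walks : ℕ → Fin m → Maybe (Fin m) → List (List (Fin m))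
  walks zero    z prev = [ [] ]
  walks (suc k) z prev = concatMap (λ w → map (w ∷_) (walks k w (just z))) (neighboursAvoiding z prev)

  ∈-walks : ∀ z prev ws → Linked (Adj G) (z ∷ ws) → Unique (z ∷ ws) → FirstAvoids prev ws →
            ws ∈ walks (length ws) z prev
  ∈-walks z prev []       _           _                 _           = here refl
  ∈-walks z prev (w ∷ ws) (zw ∷ linked) ((_ ∷ z∉ws) ∷ !w∷ws) w-avoids =
    ∈-concatMap⁺ (λ w → map (w ∷_) (walks (length ws) w (just z)))
      (lose (avoiding prev w-avoids) (∈-map⁺ (w ∷_) (∈-walks w (just z) ws linked !w∷ws (FirstAvoids-∉ z-avoided))))
    where
    avoiding : ∀ prev → FirstAvoids prev (w ∷ ws) → w ∈ neighboursAvoiding z prev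
    avoiding nothing  _   = ∈-neighbours⁺ zw
    avoiding (just p) w≢p = ∈-filter⁺ (λ w → ¬? (w Fin.≟ p)) (∈-neighbours⁺ zw) w≢p
    z-avoided : ∀ {x} → just z ≡ just x → x ∉ ws
    z-avoided refl z∈ws = All.lookup z∉ws z∈ws refl

  -- The halves of the paths on 2t vertices in which v is preceded by exactly j vertices: read
  -- backwards from v such a path gives a walk with j further vertices, forwards one with 2t-1-j.
  completions : ℕ → Fin m → ℕ → List (Fin m) → List (List (Fin m) × List (Fin m))
  completions t v j lw = map (λ rw → splitAt t (reverse lw ++ v ∷ rw)) (walks (t + t ∸ suc j) v (Data.List.head lw))

  ∈-completions : ∀ {t v j lw rw P} → rw ∈ walks (t + t ∸ suc j) v (Data.List.head lw) →
                  splitAt t (reverse lw ++ v ∷ rw) ≡ P → P ∈ completions t v j lw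
  ∈-completions {t} {v} {lw = lw} rw∈ refl = ∈-map⁺ (λ rw → splitAt t (reverse lw ++ v ∷ rw)) rw∈

  candidatesAt : ℕ → Fin m → ℕ → List (List (Fin m) × List (Fin m))
  candidatesAt t v j = concatMap (completions t v j) (walks j v nothing)

  candidates : ℕ → Fin m → List (List (Fin m) × List (Fin m))
  candidates t v = concatMap (candidatesAt t v) (upTo t)

  module _ (pre : List (Fin m)) (v : Fin m) (rw : List (Fin m)) (path : IsPath G (pre ++ v ∷ rw)) where

    private
      pre-v-rw : pre ++ v ∷ rw ≡ (pre ++ [ v ]) ++ rw
      pre-v-rw = sym (Listₚ.++-assoc pre [ v ] rw)

    reverse-prefix∈walks : reverse pre ∈ walks (length pre) v nothing
    reverse-prefix∈walks = subst (λ k → reverse pre ∈ walks k v nothing) (Listₚ.length-reverse pre)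
      (∈-walks v nothing (reverse pre)
        (subst (Linked (Adj G)) (Listₚ.reverse-++ pre [ v ])
          (Linked-reverse (Adj-sym G)
            (Linked-++⁻ˡ (pre ++ [ v ]) (subst (Linked (Adj G)) pre-v-rw (proj₂ path)))))
        (subst Unique (Listₚ.reverse-++ pre [ v ])
          (Unique-reverse (proj₁ (Unique-++⁻ (pre ++ [ v ]) (subst Unique pre-v-rw (proj₁ path))))))
        tt)

    suffix∈walks : rw ∈ walks (length rw) v (Data.List.head (reverse pre))
    suffix∈walks with Unique-++⁻ pre (proj₁ path)
    ... | _ , !v∷rw , pre#v∷rw = ∈-walks v _ rw (Linked-++⁻ʳ pre (proj₂ path)) !v∷rw
      (FirstAvoids-∉ λ head≡ x∈rw → pre#v∷rw (Anyₚ.reverse⁻ (head≡just⇒∈ head≡)) (there x∈rw))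

  ∈-candidates : ∀ {v} as bs → IsPath G (as ++ bs) → v ∈ as → length as ≡ length bs →
                 (as , bs) ∈ candidates (length as) v
  ∈-candidates {v} as bs path v∈as |as|≡|bs| with ∈-∃++ v∈as
  ... | pre , post , refl =
    ∈-concatMap⁺ (candidatesAt t v) (lose (∈-upTo⁺ j<t)
      (∈-concatMap⁺ (completions t v j) (lose (reverse-prefix∈walks pre v rw path′)
        (∈-completions {t} {v} {j} (subst (λ k → rw ∈ walks k v _) |rw|≡ (suffix∈walks pre v rw path′)) splits-as-bs))))
    where
    t j : ℕ
    t = length as
    j = length pre
    rw : List (Fin m)
    rw = post ++ bs
    as++bs≡ : as ++ bs ≡ pre ++ v ∷ rw
    as++bs≡ = Listₚ.++-assoc pre (v ∷ post) bs
    path′ : IsPath G (pre ++ v ∷ rw)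
    path′ = subst (IsPath G) as++bs≡ path
    t≡ : t ≡ j + suc (length post)
    t≡ = Listₚ.length-++ pre
    j<t : j < t
    j<t = subst (j <_) (sym t≡) (ℕₚ.m<m+n j (s≤s z≤n))
    |rw|≡ : length rw ≡ t + t ∸ suc j
    |rw|≡ = sym (begin
      t + t ∸ suc j                        ≡⟨ cong (λ x → x + t ∸ suc j) t≡ ⟩
      j + suc (length post) + t ∸ suc j   ≡⟨ cong (_∸ suc j) (trans (ℕₚ.+-assoc j _ t) (ℕₚ.+-suc j _)) ⟩
      suc j + (length post + t) ∸ suc j   ≡⟨ ℕₚ.m+n∸m≡n (suc j) _ ⟩
      length post + t                      ≡⟨ cong (length post +_) |as|≡|bs| ⟩
      length post + length bs              ≡⟨ Listₚ.length-++ post ⟨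
      length rw                            ∎)
      where open ≡-Reasoning
    splits-as-bs : splitAt t (reverse (reverse pre) ++ v ∷ rw) ≡ (as , bs)
    splits-as-bs = trans (cong (λ xs → splitAt t (xs ++ v ∷ rw)) (Listₚ.reverse-involutive pre))
                         (trans (cong (splitAt t) (sym as++bs≡)) (splitAt-++ as bs))

⌊n/2⌋+⌊n/2⌋≤n : ∀ n → ⌊ n /2⌋ + ⌊ n /2⌋ ≤ n
⌊n/2⌋+⌊n/2⌋≤n n = subst (⌊ n /2⌋ + ⌊ n /2⌋ ≤_) (ℕₚ.⌊n/2⌋+⌈n/2⌉≡n n) (ℕₚ.+-monoʳ-≤ ⌊ n /2⌋ (ℕₚ.⌊n/2⌋≤⌈n/2⌉ n))

x+x≤1+c+c⇒x≤c : ∀ {x c} → x + x ≤ suc (c + c) → x ≤ c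
x+x≤1+c+c⇒x≤c {x} {c} x+x≤ = ℕₚ.≮⇒≥ λ c<x →
  ℕₚ.<-irrefl refl (subst (_≤ suc (c + c)) (cong suc (ℕₚ.+-suc c c)) (ℕₚ.≤-trans (ℕₚ.+-mono-≤ c<x c<x) x+x≤))

⌊a/2⌋+⌈b/2⌉≤c : ∀ a b c → a + b ≡ c + c → ⌊ a /2⌋ + ⌈ b /2⌉ ≤ c
⌊a/2⌋+⌈b/2⌉≤c a b c a+b≡c+c = x+x≤1+c+c⇒x≤c (begin
  (⌊ a /2⌋ + ⌈ b /2⌉) + (⌊ a /2⌋ + ⌈ b /2⌉) ≡⟨ interchange ⌊ a /2⌋ ⌈ b /2⌉ ⌊ a /2⌋ ⌈ b /2⌉ ⟩
  (⌊ a /2⌋ + ⌊ a /2⌋) + (⌈ b /2⌉ + ⌈ b /2⌉) ≤⟨ ℕₚ.+-mono-≤ (⌊n/2⌋+⌊n/2⌋≤n a) (⌊n/2⌋+⌊n/2⌋≤n (suc b)) ⟩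
  a + suc b                                   ≡⟨ ℕₚ.+-suc a b ⟩
  suc (a + b)                                 ≡⟨ cong suc a+b≡c+c ⟩
  suc (c + c)                                 ∎)
  where open ℕₚ.≤-Reasoning

⌈a/2⌉+⌊b/2⌋≤c : ∀ a b c → a + b ≡ c + c → ⌈ a /2⌉ + ⌊ b /2⌋ ≤ c
⌈a/2⌉+⌊b/2⌋≤c a b c a+b≡c+c =
  subst (_≤ c) (ℕₚ.+-comm ⌊ b /2⌋ ⌈ a /2⌉) (⌊a/2⌋+⌈b/2⌉≤c b a c (trans (ℕₚ.+-comm b a) a+b≡c+c))

record BranchStructure (G : Graph m) (Δ : ℕ) : Set where
  open Walks G using (neighbours)
  field
    isBranch           : Fin m → Bool
    branch-degree      : ∀ z → T (isBranch z) → length (neighbours z) ≤ Δ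
    inner-degree       : ∀ z → T (not (isBranch z)) → length (neighbours z) ≤ 2
    branch-independent : ∀ z w → T (isBranch z) → Adj G z w → T (not (isBranch w))

module WalkCounting {G : Graph m} {Δ : ℕ} (2≤Δ : 2 ≤ Δ) (B : BranchStructure G Δ) where

  open Walks G
  open BranchStructure B

  d : ℕ
  d = Δ ∸ 1

  instance
    d-nonZero : ℕ.NonZero d
    d-nonZero = ℕ.>-nonZero (ℕₚ.∸-monoˡ-≤ 1 2≤Δ)

  -- A walk leaving a branch vertex alternates between at most d choices and forced steps.
  walkBound : Fin m → ℕ → ℕ
  walkBound z k = if isBranch z then d ^ ⌈ k /2⌉ else d ^ ⌊ k /2⌋

  walkBound-branch : ∀ {z} k → T (isBranch z) → walkBound z k ≡ d ^ ⌈ k /2⌉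
  walkBound-branch {z} k z∈B with isBranch z
  ... | true = refl

  walkBound-inner : ∀ {z} k → T (not (isBranch z)) → walkBound z k ≡ d ^ ⌊ k /2⌋
  walkBound-inner {z} k z∉B with isBranch z
  ... | false = refl

  walkBound≤ : ∀ z k → walkBound z k ≤ d ^ ⌈ k /2⌉
  walkBound≤ z k with isBranch z
  ... | true  = ℕₚ.≤-refl
  ... | false = ℕₚ.^-monoʳ-≤ d (ℕₚ.⌊n/2⌋≤⌈n/2⌉ k)

  isBranch? : ∀ z → T (isBranch z) ⊎ T (not (isBranch z))
  isBranch? z with isBranch z
  ... | true  = inj₁ tt
  ... | false = inj₂ tt

  neighboursAvoiding-< : ∀ {z p} → Adj G z p → length (neighboursAvoiding z (just p)) < length (neighbours z)
  neighboursAvoiding-< {z} {p} zp = Listₚ.filter-notAll (λ w → ¬? (w Fin.≟ p)) (neighbours z)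
    (Any.map (λ p≡w w≢p → w≢p (sym p≡w)) (∈-neighbours⁺ zp))

  neighboursAvoiding-branch : ∀ {z p} → T (isBranch z) → Adj G z p → length (neighboursAvoiding z (just p)) ≤ d
  neighboursAvoiding-branch {z} z∈B zp = ℕₚ.≤-pred (ℕₚ.≤-trans (neighboursAvoiding-< zp)
    (ℕₚ.≤-trans (branch-degree z z∈B) (ℕₚ.≤-reflexive (sym (ℕₚ.m+[n∸m]≡n (ℕₚ.≤-trans (s≤s z≤n) 2≤Δ))))))

  neighboursAvoiding-inner : ∀ {z p} → T (not (isBranch z)) → Adj G z p → length (neighboursAvoiding z (just p)) ≤ 1
  neighboursAvoiding-inner {z} z∉B zp = ℕₚ.≤-pred (ℕₚ.≤-trans (neighboursAvoiding-< zp) (inner-degree z z∉B))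

  neighboursAvoiding⊆ : ∀ {z prev w} → w ∈ neighboursAvoiding z prev → Adj G z w
  neighboursAvoiding⊆ {prev = nothing} w∈ = ∈-neighbours⁻ w∈
  neighboursAvoiding⊆ {z} {just p}     w∈ = ∈-neighbours⁻ (proj₁ (∈-filter⁻ (λ w → ¬? (w Fin.≟ p)) {xs = neighbours z} w∈))

  length-walks-suc : ∀ k z prev b → (∀ {w} → w ∈ neighboursAvoiding z prev → length (walks k w (just z)) ≤ b) →
                     length (walks (suc k) z prev) ≤ length (neighboursAvoiding z prev) * b
  length-walks-suc k z prev b each = length-concatMap-≤ _ (neighboursAvoiding z prev) b
    λ {w} w∈ → ℕₚ.≤-trans (ℕₚ.≤-reflexive (Listₚ.length-map (w ∷_) (walks k w (just z)))) (each w∈)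

  length-walks : ∀ k z p → Adj G z p → length (walks k z (just p)) ≤ walkBound z k
  length-walks zero    z p _  with isBranch z
  ... | true  = ℕₚ.≤-refl
  ... | false = ℕₚ.≤-refl
  length-walks (suc k) z p zp with isBranch? z
  ... | inj₁ z∈B = begin
    length (walks (suc k) z (just p))                       ≤⟨ length-walks-suc k z (just p) _ each ⟩
    length (neighboursAvoiding z (just p)) * d ^ ⌊ k /2⌋    ≤⟨ ℕₚ.*-monoˡ-≤ _ (neighboursAvoiding-branch z∈B zp) ⟩
    d ^ ⌈ suc k /2⌉                                         ≡⟨ walkBound-branch (suc k) z∈B ⟨
    walkBound z (suc k)                                     ∎
    where
    open ℕₚ.≤-Reasoning
    each : ∀ {w} → w ∈ neighboursAvoiding z (just p) → length (walks k w (just z)) ≤ d ^ ⌊ k /2⌋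
    each {w} w∈ = subst (_ ≤_) (walkBound-inner k (branch-independent z w z∈B (neighboursAvoiding⊆ {z} {just p} w∈)))
                               (length-walks k w z (Adj-sym G (neighboursAvoiding⊆ {z} {just p} w∈)))
  ... | inj₂ z∉B = begin
    length (walks (suc k) z (just p))                       ≤⟨ length-walks-suc k z (just p) _ each ⟩
    length (neighboursAvoiding z (just p)) * d ^ ⌈ k /2⌉    ≤⟨ ℕₚ.*-monoˡ-≤ _ (neighboursAvoiding-inner z∉B zp) ⟩
    1 * d ^ ⌈ k /2⌉                                         ≡⟨ ℕₚ.*-identityˡ _ ⟩
    d ^ ⌊ suc k /2⌋                                         ≡⟨ walkBound-inner (suc k) z∉B ⟨
    walkBound z (suc k)                                     ∎
    where
    open ℕₚ.≤-Reasoning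
    each : ∀ {w} → w ∈ neighboursAvoiding z (just p) → length (walks k w (just z)) ≤ d ^ ⌈ k /2⌉
    each {w} w∈ = ℕₚ.≤-trans (length-walks k w z (Adj-sym G (neighboursAvoiding⊆ {z} {just p} w∈))) (walkBound≤ w k)

  length-walks-branch : ∀ k {z} → T (isBranch z) → length (walks (suc k) z nothing) ≤ Δ * d ^ ⌊ k /2⌋
  length-walks-branch k {z} z∈B = ℕₚ.≤-trans (length-walks-suc k z nothing _ each) (ℕₚ.*-monoˡ-≤ _ (branch-degree z z∈B))
    where
    each : ∀ {w} → w ∈ neighbours z → length (walks k w (just z)) ≤ d ^ ⌊ k /2⌋
    each {w} w∈ = subst (_ ≤_) (walkBound-inner k (branch-independent z w z∈B (∈-neighbours⁻ w∈)))
                               (length-walks k w z (Adj-sym G (∈-neighbours⁻ w∈)))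

  length-walks-inner : ∀ k {z} → T (not (isBranch z)) → length (walks (suc k) z nothing) ≤ 2 * d ^ ⌈ k /2⌉
  length-walks-inner k {z} z∉B = ℕₚ.≤-trans (length-walks-suc k z nothing _ each) (ℕₚ.*-monoˡ-≤ _ (inner-degree z z∉B))
    where
    each : ∀ {w} → w ∈ neighbours z → length (walks k w (just z)) ≤ d ^ ⌈ k /2⌉
    each {w} w∈ = ℕₚ.≤-trans (length-walks k w z (Adj-sym G (∈-neighbours⁻ w∈))) (walkBound≤ w k)

  head-walk : ∀ {j v lw} → lw ∈ walks (suc j) v nothing → ∃[ w ] Data.List.head lw ≡ just w × Adj G v w
  head-walk {j} {v} lw∈ with find (∈-concatMap⁻ (λ w → map (w ∷_) (walks j w (just v))) {xs = neighbours v} lw∈)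
  ... | w , w∈ , lw∈w with ∈-map⁻ (w ∷_) lw∈w
  ... | _ , _ , refl = w , refl , ∈-neighbours⁻ w∈

  ^-split : ∀ {x y c} → x + y ≤ c → d ^ x * d ^ y ≤ d ^ c
  ^-split {x} {y} {c} x+y≤c = subst (_≤ d ^ c) (ℕₚ.^-distribˡ-+-* d x y) (ℕₚ.^-monoʳ-≤ d x+y≤c)

  candidatesAt-zero-length : ∀ c v → length (candidatesAt (suc c) v 0) ≤ Δ * d ^ c
  candidatesAt-zero-length c v = ℕₚ.≤-trans
    (length-concatMap-≤ (completions (suc c) v 0) (walks 0 v nothing) (Δ * d ^ c) λ { (here refl) →
      subst (_≤ Δ * d ^ c) (sym (Listₚ.length-map _ (walks (c + suc c) v nothing)))
        (subst (λ k → length (walks k v nothing) ≤ Δ * d ^ c) (sym (ℕₚ.+-suc c c)) right-walks) })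
    (ℕₚ.≤-reflexive (ℕₚ.*-identityˡ (Δ * d ^ c)))
    where
    right-walks : length (walks (suc (c + c)) v nothing) ≤ Δ * d ^ c
    right-walks with isBranch? v
    ... | inj₁ v∈B = subst (λ x → length (walks (suc (c + c)) v nothing) ≤ Δ * d ^ x) (sym (ℕₚ.n≡⌊n+n/2⌋ c))
                           (length-walks-branch (c + c) v∈B)
    ... | inj₂ v∉B = ℕₚ.≤-trans (subst (λ x → length (walks (suc (c + c)) v nothing) ≤ 2 * d ^ x) (sym (ℕₚ.n≡⌈n+n/2⌉ c))
                                       (length-walks-inner (c + c) v∉B))
                                (ℕₚ.*-monoˡ-≤ _ 2≤Δ)

  -- Apart from v and its left neighbour the two walks cover j + R = 2c vertices, so the
  -- exponents in their bounds add up to at most c.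
  candidatesAt-suc-length : ∀ c v j → j < c → length (candidatesAt (suc c) v (suc j)) ≤ Δ * d ^ c
  candidatesAt-suc-length c v j j<c =
    ℕₚ.≤-trans (length-concatMap-≤ (completions (suc c) v (suc j)) (walks (suc j) v nothing) (walkBound v R) right-walks) product-bound
    where
    R : ℕ
    R = c + suc c ∸ suc j
    j+R≡c+c : j + R ≡ c + c
    j+R≡c+c = trans (cong (λ x → j + (x ∸ suc j)) (ℕₚ.+-suc c c)) (ℕₚ.m+[n∸m]≡n (ℕₚ.≤-trans (ℕₚ.<⇒≤ j<c) (ℕₚ.m≤m+n c c)))
    right-walks : ∀ {lw} → lw ∈ walks (suc j) v nothing → length (completions (suc c) v (suc j) lw) ≤ walkBound v R
    right-walks {lw} lw∈ with head-walk {j} lw∈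
    ... | w , head≡ , vw = subst (_≤ walkBound v R) (sym (Listₚ.length-map _ (walks R v (Data.List.head lw))))
                             (subst (λ h → length (walks R v h) ≤ walkBound v R) (sym head≡) (length-walks R v w vw))
    product-bound : length (walks (suc j) v nothing) * walkBound v R ≤ Δ * d ^ c
    product-bound with isBranch? v
    ... | inj₁ v∈B = begin
      length (walks (suc j) v nothing) * walkBound v R  ≤⟨ ℕₚ.*-mono-≤ (length-walks-branch j v∈B)
                                                                         (ℕₚ.≤-reflexive (walkBound-branch R v∈B)) ⟩
      Δ * d ^ ⌊ j /2⌋ * d ^ ⌈ R /2⌉                     ≡⟨ ℕₚ.*-assoc Δ _ _ ⟩
      Δ * (d ^ ⌊ j /2⌋ * d ^ ⌈ R /2⌉)                   ≤⟨ ℕₚ.*-monoʳ-≤ Δ (^-split {⌊ j /2⌋} {⌈ R /2⌉} (⌊a/2⌋+⌈b/2⌉≤c j R c j+R≡c+c)) ⟩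
      Δ * d ^ c                                          ∎
      where open ℕₚ.≤-Reasoning
    ... | inj₂ v∉B = begin
      length (walks (suc j) v nothing) * walkBound v R  ≤⟨ ℕₚ.*-mono-≤ (ℕₚ.≤-trans (length-walks-inner j v∉B) (ℕₚ.*-monoˡ-≤ _ 2≤Δ))
                                                                         (ℕₚ.≤-reflexive (walkBound-inner R v∉B)) ⟩
      Δ * d ^ ⌈ j /2⌉ * d ^ ⌊ R /2⌋                     ≡⟨ ℕₚ.*-assoc Δ _ _ ⟩
      Δ * (d ^ ⌈ j /2⌉ * d ^ ⌊ R /2⌋)                   ≤⟨ ℕₚ.*-monoʳ-≤ Δ (^-split {⌈ j /2⌉} {⌊ R /2⌋} (⌈a/2⌉+⌊b/2⌋≤c j R c j+R≡c+c)) ⟩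
      Δ * d ^ c                                          ∎
      where open ℕₚ.≤-Reasoning

  candidatesAt-length : ∀ c v j → j < suc c → length (candidatesAt (suc c) v j) ≤ Δ * d ^ c
  candidatesAt-length c v zero    _           = candidatesAt-zero-length c v
  candidatesAt-length c v (suc j) (s≤s j<c) = candidatesAt-suc-length c v j j<c

  candidates-length : ∀ c v → length (candidates (suc c) v) ≤ suc c * (Δ * d ^ c)
  candidates-length c v = ℕₚ.≤-trans
    (length-concatMap-≤ (candidatesAt (suc c) v) (upTo (suc c)) (Δ * d ^ c) (candidatesAt-length c v _ ∘ ∈-upTo⁻))
    (ℕₚ.≤-reflexive (cong (_* (Δ * d ^ c)) (Listₚ.length-upTo (suc c))))

─-∷ : ∀ (U : VertexSet m) w ws → U ─ (w ∷ ws) ≗ (U ─ ws) ─ [ w ]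
─-∷ U w ws z = trans (─-cong U {w ∷ ws} {ws ++ [ w ]} to from z) (sym (─-─ U ws [ w ] z))
  where
  to : ∀ {z} → z ∈ w ∷ ws → z ∈ ws ++ [ w ]
  to (here refl) = ∈-++⁺ʳ ws (here refl)
  to (there z∈)  = ∈-++⁺ˡ z∈
  from : ∀ {z} → z ∈ ws ++ [ w ] → z ∈ w ∷ ws
  from z∈ = [ there , (λ { (here refl) → here refl }) ]′ (∈-++⁻ ws z∈)

─-remove-first : ∀ (U : VertexSet m) pre v post → U ─ (pre ++ v ∷ post) ≗ (U ─ [ v ]) ─ (pre ++ post)
─-remove-first U pre v post z = trans (─-cong U {pre ++ v ∷ post} {v ∷ pre ++ post} to from z) (sym (─-─ U [ v ] (pre ++ post) z))
  where
  to : ∀ {z} → z ∈ pre ++ v ∷ post → z ∈ v ∷ pre ++ post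
  to z∈ with ∈-++⁻ pre z∈
  ... | inj₁ z∈pre         = there (∈-++⁺ˡ z∈pre)
  ... | inj₂ (here refl)   = here refl
  ... | inj₂ (there z∈post) = there (∈-++⁺ʳ pre z∈post)
  from : ∀ {z} → z ∈ v ∷ pre ++ post → z ∈ pre ++ v ∷ post
  from (here refl) = ∈-++⁺ʳ pre (here refl)
  from (there z∈) = [ ∈-++⁺ˡ , ∈-++⁺ʳ pre ∘ there ]′ (∈-++⁻ pre z∈)

─-factor : ∀ (U : VertexSet m) {v S} → Unique S → All (_∈ᵛ U) S → v ∈ S →
           ∃[ ws ] Unique ws × All (_∈ᵛ (U ─ [ v ])) ws × suc (length ws) ≡ length S × U ─ S ≗ (U ─ [ v ]) ─ ws
─-factor U {v} !S S⊆U v∈S with ∈-∃++ v∈S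
... | pre , post , refl = pre ++ post , Unique-drop-middle pre post !S , All.tabulate ws⊆U-v ,
                          sym (Listₚ.length-++-sucʳ pre v post) , ─-remove-first U pre v post
  where
  v∉ws : v ∉ pre ++ post
  v∉ws v∈ws with Unique-++⁻ pre !S | ∈-++⁻ pre v∈ws
  ... | _ , _ , pre#v∷post   | inj₁ v∈pre  = pre#v∷post v∈pre (here refl)
  ... | _ , v∉post ∷ _ , _   | inj₂ v∈post = All.lookup v∉post v∈post refl
  ws⊆U-v : ∀ {z} → z ∈ pre ++ post → z ∈ᵛ (U ─ [ v ])
  ws⊆U-v {z} z∈ws = ∈ᵛ-─⁺ U [ v ] z (All.lookup S⊆U ([ ∈-++⁺ˡ , ∈-++⁺ʳ pre ∘ there ]′ (∈-++⁻ pre z∈ws)))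
    λ { (here refl) → v∉ws z∈ws }

module MainInequality {m} {G : Graph m} {L : ListAssignment m} (L-unique : ∀ z → Unique (L z))
  {Δ : ℕ} (2≤Δ : 2 ≤ Δ) (B : BranchStructure G Δ) {r : ℚ} (0<r : 0ℚ ℚ.< r) (0<1-r : 0ℚ ℚ.< 1ℚ ℚ.- r)
  (L-large : ∀ z → beta Δ r 0<r ℚ.+ Δ/[1-r]² Δ r 0<1-r ℚ.≤ ℕ→ℚ (length (L z))) where

  open Enumeration G L L-unique
  open Walks G
  open WalkCounting 2≤Δ B
  open +-*-Solver

  β : ℚ
  β = beta Δ r 0<r

  D : ℚ
  D = Δ/[1-r]² Δ r 0<1-r

  0≤r : 0ℚ ℚ.≤ r
  0≤r = ℚₚ.<⇒≤ 0<r

  0≤β : 0ℚ ℚ.≤ β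
  0≤β = *-nonNeg (ℕ→ℚ-nonNeg (Δ ∸ 1)) (ℚₚ.<⇒≤ (1/-pos r 0<r))

  β*r≡d : β ℚ.* r ≡ ℕ→ℚ d
  β*r≡d = trans (ℚₚ.*-assoc (ℕ→ℚ d) _ r) (trans (cong (ℕ→ℚ d ℚ.*_) (ℚₚ.*-inverseˡ r {{ℚ.>-nonZero 0<r}})) (ℚₚ.*-identityʳ (ℕ→ℚ d)))

  module Step {U : VertexSet m} {v : Fin m} (v∈U : v ∈ᵛ U)
              (IH : ∀ W → size W < size U → ∀ w → w ∈ᵛ W → β ℚ.* ℕ→ℚ (Π (W ─ [ w ])) ℚ.≤ ℕ→ℚ (Π W)) where

    N : ℕ
    N = Π (U ─ [ v ])

    β-removals : ∀ W ws → size W < size U → Unique ws → All (_∈ᵛ W) ws →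
               pow β (length ws) ℚ.* ℕ→ℚ (Π (W ─ ws)) ℚ.≤ ℕ→ℚ (Π W)
    β-removals W []       _   _             _            = ℚₚ.≤-reflexive (trans (ℚₚ.*-identityˡ _) (cong ℕ→ℚ (Π-cong (─-[] W))))
    β-removals W (w ∷ ws) W<U (w∉ws ∷ !ws) (w∈W ∷ ws⊆W) = begin
      pow β (suc (length ws)) ℚ.* ℕ→ℚ (Π (W ─ (w ∷ ws)))      ≡⟨ cong (λ n → pow β (suc (length ws)) ℚ.* ℕ→ℚ n) (Π-cong (─-∷ W w ws)) ⟩
      β ℚ.* pow β (length ws) ℚ.* ℕ→ℚ (Π ((W ─ ws) ─ [ w ]))  ≡⟨ xy∙z≈y∙xz β (pow β (length ws)) _ ⟩
      pow β (length ws) ℚ.* (β ℚ.* ℕ→ℚ (Π ((W ─ ws) ─ [ w ]))) ≤⟨ *-monoˡ-≤-nonNeg _ (pow-nonNeg β (length ws) 0≤β)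
                                                                      (IH (W ─ ws) W-ws<U w w∈W-ws) ⟩
      pow β (length ws) ℚ.* ℕ→ℚ (Π (W ─ ws))                   ≤⟨ β-removals W ws W<U !ws ws⊆W ⟩
      ℕ→ℚ (Π W)                                                 ∎
      where
      open ℚₚ.≤-Reasoning
      W-ws<U : size (W ─ ws) < size U
      W-ws<U = ℕₚ.≤-<-trans (size-─ W ws) W<U
      w∈W-ws : w ∈ᵛ (W ─ ws)
      w∈W-ws = ∈ᵛ-─⁺ W ws w w∈W λ w∈ws → All.lookup w∉ws w∈ws refl

    β-removals-via-v : ∀ c S → Unique S → All (_∈ᵛ U) S → v ∈ S → length S ≡ suc c →
                         pow β c ℚ.* ℕ→ℚ (Π (U ─ S)) ℚ.≤ ℕ→ℚ N
    β-removals-via-v c S !S S⊆U v∈S |S|≡1+c =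
      let ws , !ws , ws⊆U-v , 1+|ws|≡|S| , U-S≗ = ─-factor U !S S⊆U v∈S
      in subst₂ (λ k n → pow β k ℚ.* ℕ→ℚ n ℚ.≤ ℕ→ℚ N) (ℕₚ.suc-injective (trans 1+|ws|≡|S| |S|≡1+c)) (sym (Π-cong U-S≗))
           (β-removals (U ─ [ v ]) ws (size-─-< U v v∈U) !ws ws⊆U-v)

    d-removals-via-v : ∀ c S → Unique S → All (_∈ᵛ U) S → v ∈ S → length S ≡ suc c →
                      ℕ→ℚ (d ^ c) ℚ.* ℕ→ℚ (Π (U ─ S)) ℚ.≤ pow r c ℚ.* ℕ→ℚ N
    d-removals-via-v c S !S S⊆U v∈S |S|≡1+c = begin
      ℕ→ℚ (d ^ c) ℚ.* ℕ→ℚ (Π (U ─ S))               ≡⟨ cong (ℚ._* ℕ→ℚ (Π (U ─ S))) d^c≡ ⟩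
      pow β c ℚ.* pow r c ℚ.* ℕ→ℚ (Π (U ─ S))       ≡⟨ xy∙z≈y∙xz (pow β c) (pow r c) _ ⟩
      pow r c ℚ.* (pow β c ℚ.* ℕ→ℚ (Π (U ─ S)))     ≤⟨ *-monoˡ-≤-nonNeg (pow r c) (pow-nonNeg r c 0≤r)
                                                          (β-removals-via-v c S !S S⊆U v∈S |S|≡1+c) ⟩
      pow r c ℚ.* ℕ→ℚ N                               ∎
      where
      open ℚₚ.≤-Reasoning
      d^c≡ : ℕ→ℚ (d ^ c) ≡ pow β c ℚ.* pow r c
      d^c≡ = trans (sym (pow-ℕ→ℚ d c)) (trans (cong (λ x → pow x c) (sym β*r≡d)) (pow-distrib-* β r c))

    IsCandidate : ℕ → List (Fin m) × List (Fin m) → Set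
    IsCandidate t (S , _) = Unique S × All (_∈ᵛ U) S × v ∈ S × length S ≡ t

    isCandidate? : ∀ t P → Dec (IsCandidate t P)
    isCandidate? t (S , _) = AllPairs.allPairs? (λ x y → ¬? (x Fin.≟ y)) S ×-dec All.all? (λ z → T? (U z)) S
                             ×-dec (v ∈?ᶠ S) ×-dec (length S ℕ.≟ t)

    candidatesOfLength : ℕ → List (List (Fin m) × List (Fin m))
    candidatesOfLength t = filter (isCandidate? t) (candidates t v)

    allCandidates : List (List (Fin m) × List (Fin m))
    allCandidates = concatMap (candidatesOfLength ∘ suc) (downFrom m)

    covered : HalvesCoveredBy G U v allCandidates
    covered []        _  _    _      ()
    covered (a ∷ as) bs path inside v∈as |as|≡|bs| =
      ∈-concatMap⁺ (candidatesOfLength ∘ suc) (lose (∈-downFrom⁺ (ℕₚ.<-≤-trans (ℕₚ.n<1+n _) |as|≤m))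
        (∈-filter⁺ (isCandidate? _) (∈-candidates (a ∷ as) bs path v∈as |as|≡|bs|)
          (proj₁ (Unique-++⁻ (a ∷ as) (proj₁ path)) , Allₚ.++⁻ˡ (a ∷ as) inside , v∈as , refl)))
      where
      |as|≤m : length (a ∷ as) ≤ m
      |as|≤m = ℕₚ.≤-trans (Listₚ.length-++-≤ˡ (a ∷ as)) (IsPath⇒length≤ G path)

    Π-without : List (Fin m) × List (Fin m) → ℕ
    Π-without (S , _) = Π (U ─ S)

    candidatesOfLength-bound : ∀ c → ℕ→ℚ (sum (map Π-without (candidatesOfLength (suc c)))) ℚ.≤
                                     ℕ→ℚ Δ ℚ.* (ℕ→ℚ (suc c) ℚ.* pow r c) ℚ.* ℕ→ℚ N
    candidatesOfLength-bound c = ℚₚ.*-cancelˡ-≤-pos (ℕ→ℚ (d ^ c)) {{ℚ.positive (ℕ→ℚ-pos (ℕₚ.m^n>0 d c))}} (begin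
      ℕ→ℚ (d ^ c) ℚ.* ℕ→ℚ (sum (map Π-without Cs))
        ≤⟨ *-sum-≤ Π-without Cs (ℕ→ℚ (d ^ c)) (pow r c ℚ.* ℕ→ℚ N) each ⟩
      ℕ→ℚ (length Cs) ℚ.* (pow r c ℚ.* ℕ→ℚ N)
        ≤⟨ *-monoʳ-≤-nonNeg (pow r c ℚ.* ℕ→ℚ N) (*-nonNeg (pow-nonNeg r c 0≤r) (ℕ→ℚ-nonNeg N))
             (ℕ→ℚ-mono-≤ (ℕₚ.≤-trans (Listₚ.length-filter (isCandidate? (suc c)) (candidates (suc c) v)) (candidates-length c v))) ⟩
      ℕ→ℚ (suc c * (Δ * d ^ c)) ℚ.* (pow r c ℚ.* ℕ→ℚ N)
        ≡⟨ cong (ℚ._* (pow r c ℚ.* ℕ→ℚ N)) (trans (ℕ→ℚ-* (suc c) (Δ * d ^ c)) (cong (ℕ→ℚ (suc c) ℚ.*_) (ℕ→ℚ-* Δ (d ^ c)))) ⟩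
      ℕ→ℚ (suc c) ℚ.* (ℕ→ℚ Δ ℚ.* ℕ→ℚ (d ^ c)) ℚ.* (pow r c ℚ.* ℕ→ℚ N)
        ≡⟨ solve 5 (λ t δ x p n → (t :* (δ :* x)) :* (p :* n) := x :* (δ :* (t :* p) :* n)) refl
                   (ℕ→ℚ (suc c)) (ℕ→ℚ Δ) (ℕ→ℚ (d ^ c)) (pow r c) (ℕ→ℚ N) ⟩
      ℕ→ℚ (d ^ c) ℚ.* (ℕ→ℚ Δ ℚ.* (ℕ→ℚ (suc c) ℚ.* pow r c) ℚ.* ℕ→ℚ N) ∎)
      where
      open ℚₚ.≤-Reasoning
      Cs : List (List (Fin m) × List (Fin m))
      Cs = candidatesOfLength (suc c)
      each : ∀ {P} → P ∈ Cs → ℕ→ℚ (d ^ c) ℚ.* ℕ→ℚ (Π-without P) ℚ.≤ pow r c ℚ.* ℕ→ℚ N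
      each {S , _} P∈ = let !S , S⊆U , v∈S , |S|≡ = proj₂ (∈-filter⁻ (isCandidate? (suc c)) {xs = candidates (suc c) v} P∈)
                        in d-removals-via-v c S !S S⊆U v∈S |S|≡

    Σ-candidates : ℕ → ℕ
    Σ-candidates T = sum (map (λ c → sum (map Π-without (candidatesOfLength (suc c)))) (downFrom T))

    Σ-candidates-bound : ∀ T → ℕ→ℚ (Σ-candidates T) ℚ.≤ ℕ→ℚ Δ ℚ.* weightedGeometricSum r T ℚ.* ℕ→ℚ N
    Σ-candidates-bound zero    = ℚₚ.≤-reflexive (solve 2 (λ δ n → con 0ℚ := δ :* con 0ℚ :* n) refl (ℕ→ℚ Δ) (ℕ→ℚ N))
    Σ-candidates-bound (suc T) = begin
      ℕ→ℚ (sum (map Π-without (candidatesOfLength (suc T))) + Σ-candidates T)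
        ≡⟨ ℕ→ℚ-+ (sum (map Π-without (candidatesOfLength (suc T)))) (Σ-candidates T) ⟩
      ℕ→ℚ (sum (map Π-without (candidatesOfLength (suc T)))) ℚ.+ ℕ→ℚ (Σ-candidates T)
        ≤⟨ ℚₚ.+-mono-≤ (candidatesOfLength-bound T) (Σ-candidates-bound T) ⟩
      ℕ→ℚ Δ ℚ.* (ℕ→ℚ (suc T) ℚ.* pow r T) ℚ.* ℕ→ℚ N ℚ.+ ℕ→ℚ Δ ℚ.* weightedGeometricSum r T ℚ.* ℕ→ℚ N
        ≡⟨ solve 4 (λ δ x s n → δ :* x :* n :+ δ :* s :* n := δ :* (s :+ x) :* n) refl
                   (ℕ→ℚ Δ) (ℕ→ℚ (suc T) ℚ.* pow r T) (weightedGeometricSum r T) (ℕ→ℚ N) ⟩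
      ℕ→ℚ Δ ℚ.* weightedGeometricSum r (suc T) ℚ.* ℕ→ℚ N ∎
      where open ℚₚ.≤-Reasoning

    bad-extensions-bound : ℕ→ℚ (Σ-candidates m) ℚ.≤ D ℚ.* ℕ→ℚ N
    bad-extensions-bound = ℚₚ.≤-trans (Σ-candidates-bound m)
      (*-monoʳ-≤-nonNeg (ℕ→ℚ N) (ℕ→ℚ-nonNeg N) (*-weightedGeometricSum-≤ Δ r m 0≤r 0<1-r))

    extension-count : length (L v) * N ≤ Π U + Σ-candidates m
    extension-count = subst (λ n → length (L v) * N ≤ Π U + n) (sum-map-concatMap Π-without (candidatesOfLength ∘ suc) (downFrom m))
      (Extension.extension-count G L L-unique v∈U allCandidates covered)

    β-removal-step : β ℚ.* ℕ→ℚ N ℚ.≤ ℕ→ℚ (Π U)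
    β-removal-step = +-cancelʳ-≤ (β ℚ.* ℕ→ℚ N) (ℕ→ℚ (Π U)) (D ℚ.* ℕ→ℚ N) (begin
      β ℚ.* ℕ→ℚ N ℚ.+ D ℚ.* ℕ→ℚ N              ≡⟨ ℚₚ.*-distribʳ-+ (ℕ→ℚ N) β D ⟨
      (β ℚ.+ D) ℚ.* ℕ→ℚ N                       ≤⟨ *-monoʳ-≤-nonNeg (ℕ→ℚ N) (ℕ→ℚ-nonNeg N) (L-large v) ⟩
      ℕ→ℚ (length (L v)) ℚ.* ℕ→ℚ N              ≡⟨ ℕ→ℚ-* (length (L v)) N ⟨
      ℕ→ℚ (length (L v) * N)                     ≤⟨ ℕ→ℚ-mono-≤ extension-count ⟩
      ℕ→ℚ (Π U + Σ-candidates m)                 ≡⟨ ℕ→ℚ-+ (Π U) (Σ-candidates m) ⟩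
      ℕ→ℚ (Π U) ℚ.+ ℕ→ℚ (Σ-candidates m)        ≤⟨ ℚₚ.+-monoʳ-≤ (ℕ→ℚ (Π U)) bad-extensions-bound ⟩
      ℕ→ℚ (Π U) ℚ.+ D ℚ.* ℕ→ℚ N                 ∎)
      where open ℚₚ.≤-Reasoning

  β-removal-bounded : ∀ s U → size U < s → ∀ v → v ∈ᵛ U → β ℚ.* ℕ→ℚ (Π (U ─ [ v ])) ℚ.≤ ℕ→ℚ (Π U)
  β-removal-bounded (suc s) U |U|≤s v v∈U = Step.β-removal-step v∈U λ W W<U w w∈W →
    β-removal-bounded s W (ℕₚ.<-≤-trans W<U (ℕₚ.≤-pred |U|≤s)) w w∈W

  β-removal : ∀ U v → v ∈ᵛ U → β ℚ.* ℕ→ℚ (Π (U ─ [ v ])) ℚ.≤ ℕ→ℚ (Π U)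
  β-removal U = β-removal-bounded (suc (size U)) U ℕₚ.≤-refl

successor : Fin m → List (Fin m) → Fin m
successor z []       = z
successor z (a ∷ xs) = if does (z Fin.≟ a) then headOr z xs else successor z xs

successor-unique : ∀ {z w : Fin m} as bs → Unique (as ++ z ∷ w ∷ bs) → successor z (as ++ z ∷ w ∷ bs) ≡ w
successor-unique {z = z} []       bs _ with z Fin.≟ z
... | yes _   = refl
... | no z≢z = ⊥-elim (z≢z refl)
successor-unique {z = z} (a ∷ as) bs (a∉ ∷ !p) with z Fin.≟ a
... | yes refl = ⊥-elim (All.lookup a∉ (∈-++⁺ʳ as (here refl)) refl)
... | no _     = successor-unique as bs !p

length-filter-T : ∀ {k} (b : Fin k → Bool) xs → length (filter (λ y → T? (b y)) xs) ≡ sum (map (λ y → if b y then 1 else 0) xs)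
length-filter-T b []       = refl
length-filter-T b (y ∷ xs) with b y
... | true  = cong suc (length-filter-T b xs)
... | false = length-filter-T b xs

module SubdivisionBranches {k m} {H : Graph k} {G : Graph m} (sd : Subdivision H G) where

  open Subdivision sd
  open Walks G using (neighbours; ∈-neighbours⁻; neighbours-unique)

  isBranch : Fin m → Bool
  isBranch z = does (Finₚ.any? λ u → branch u Fin.≟ z)

  isBranch⁻ : ∀ {z} → T (isBranch z) → ∃[ u ] branch u ≡ z
  isBranch⁻ {z} z∈B with Finₚ.any? (λ u → branch u Fin.≟ z)
  ... | yes z∈ = z∈

  isBranch-∉ : ∀ {z} → T (not (isBranch z)) → ∀ u → branch u ≢ z
  isBranch-∉ {z} z∉B u u≡z with Finₚ.any? (λ u → branch u Fin.≟ z)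
  ... | no z∉ = z∉ (u , u≡z)

  edgePath : Fin k → Fin k → List (Fin m)
  edgePath x y = branch x ∷ inner x y ++ [ branch y ]

  branch∉inner : ∀ {x y} → x Fin.< y → Adj H x y → ∀ u → branch u ∉ inner x y
  branch∉inner x<y xy u bu∈ = inner-branch _ _ x<y xy _ bu∈ u refl

  isBranch⇒∉inner : ∀ {x y} → x Fin.< y → Adj H x y → ∀ {z} → T (isBranch z) → z ∉ inner x y
  isBranch⇒∉inner x<y xy z∈B with isBranch⁻ z∈B
  ... | u , refl = branch∉inner x<y xy u

  neighbour-of-branch∈inner : ∀ {z w} → T (isBranch z) → Adj G z w →
                              ∃[ x ] ∃[ y ] x Fin.< y × Adj H x y × w ∈ inner x y
  neighbour-of-branch∈inner {z} {w} z∈B zw with cover-edge z w zw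
  ... | x , y , x<y , xy , inj₁ (as , bs , eq) = x , y , x<y , xy ,
    subst (_∈ inner x y) (sym (proj₂ (first-pair (branch x) (inner x y) (branch y) as z w bs (sym eq)
                                        (isBranch⇒∉inner x<y xy z∈B) (inner-ne x y x<y xy))))
      (headOr-∈ (branch x) (inner x y) (inner-ne x y x<y xy))
  ... | x , y , x<y , xy , inj₂ (as , bs , eq) = x , y , x<y , xy , Anyₚ.reverse⁻
    (subst (_∈ reverse (inner x y)) (sym (proj₂ (last-pair (branch x) (inner x y) (branch y) as w z bs (sym eq)
                                                   (isBranch⇒∉inner x<y xy z∈B) (inner-ne x y x<y xy))))
      (headOr-∈ (branch y) (reverse (inner x y)) (reverse≢[] (inner-ne x y x<y xy))))

  branch-independent : ∀ z w → T (isBranch z) → Adj G z w → T (not (isBranch w))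
  branch-independent z w z∈B zw with isBranch w in eq
  ... | false = tt
  ... | true  = let x , y , x<y , xy , w∈inner = neighbour-of-branch∈inner z∈B zw
                in isBranch⇒∉inner x<y xy (subst T (sym eq) tt) w∈inner

  neighboursH : Fin k → List (Fin k)
  neighboursH x = filter (λ y → T? (adj H x y)) (allFin k)

  -- The neighbour of branch x on the path subdividing the edge xy.
  towards : Fin k → Fin k → Fin m
  towards x y with x Fin.<? y
  ... | yes _ = headOr (branch x) (inner x y)
  ... | no _  = headOr (branch x) (reverse (inner y x))

  towards-< : ∀ {x y} → x Fin.< y → towards x y ≡ headOr (branch x) (inner x y)
  towards-< {x} {y} x<y with x Fin.<? y
  ... | yes _   = refl
  ... | no x≮y = ⊥-elim (x≮y x<y)

  towards-> : ∀ {x y} → y Fin.< x → towards x y ≡ headOr (branch x) (reverse (inner y x))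
  towards-> {x} {y} y<x with x Fin.<? y
  ... | yes x<y = ⊥-elim (Finₚ.<-asym x<y y<x)
  ... | no _    = refl

  neighbours-branch : ∀ x {w} → w ∈ neighbours (branch x) → w ∈ map (towards x) (neighboursH x)
  neighbours-branch x {w} w∈ with cover-edge (branch x) w (∈-neighbours⁻ w∈)
  ... | x′ , y , x′<y , x′y , inj₁ (as , bs , eq)
    with first-pair (branch x′) (inner x′ y) (branch y) as (branch x) w bs (sym eq)
                    (branch∉inner x′<y x′y x) (inner-ne x′ y x′<y x′y)
  ... | x≡x′ , w≡ with branch-inj x x′ x≡x′
  ... | refl = subst (_∈ map (towards x) (neighboursH x)) (trans (towards-< x′<y) (sym w≡))
                 (∈-map⁺ (towards x) (∈-filter⁺ (λ y → T? (adj H x y)) (∈-allFin y) x′y))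
  neighbours-branch x {w} w∈ | x′ , y , x′<y , x′y , inj₂ (as , bs , eq)
    with last-pair (branch x′) (inner x′ y) (branch y) as w (branch x) bs (sym eq)
                   (branch∉inner x′<y x′y x) (inner-ne x′ y x′<y x′y)
  ... | x≡y , w≡ with branch-inj x y x≡y
  ... | refl = subst (_∈ map (towards x) (neighboursH x)) (trans (towards-> x′<y) (sym w≡))
                 (∈-map⁺ (towards x) (∈-filter⁺ (λ y → T? (adj H x y)) (∈-allFin x′) (Adj-sym H x′y)))

  branch-degree : ∀ {Δ} → (∀ x → degree H x ≤ Δ) → ∀ z → T (isBranch z) → length (neighbours z) ≤ Δ
  branch-degree {Δ} H-degree z z∈B with isBranch⁻ z∈B
  ... | x , refl = begin
    length (neighbours (branch x))          ≤⟨ Unique⇒length-mono-⊆ (neighbours-unique (branch x)) (neighbours-branch x) ⟩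
    length (map (towards x) (neighboursH x)) ≡⟨ Listₚ.length-map (towards x) (neighboursH x) ⟩
    length (neighboursH x)                   ≡⟨ length-filter-T (adj H x) (allFin k) ⟩
    degree H x                               ≤⟨ H-degree x ⟩
    Δ                                        ∎
    where open ℕₚ.≤-Reasoning

  -- An inner vertex lies on a single subdivision path, and its neighbours are its successors
  -- along that path and along its reverse.
  inner-degree : ∀ z → T (not (isBranch z)) → length (neighbours z) ≤ 2
  inner-degree z z∉B with cover-vertex z
  ... | inj₁ (u , bu≡z)                    = ⊥-elim (isBranch-∉ z∉B u bu≡z)
  ... | inj₂ (x , y , x<y , xy , z∈inner) = Unique⇒length-mono-⊆ (neighbours-unique z) ⊆ends
    where
    P : List (Fin m)
    P = edgePath x y
    !P : Unique P
    !P = proj₁ (is-path x y x<y xy)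
    ∈edgePath⇒∈inner : ∀ {x′ y′} → z ∈ edgePath x′ y′ → z ∈ inner x′ y′
    ∈edgePath⇒∈inner z∈ = ∈-middle _ z∈ (λ z≡ → isBranch-∉ z∉B _ (sym z≡)) (λ z≡ → isBranch-∉ z∉B _ (sym z≡))
    ⊆ends : ∀ {w} → w ∈ neighbours z → w ∈ successor z P ∷ successor z (reverse P) ∷ []
    ⊆ends {w} w∈ with cover-edge z w (∈-neighbours⁻ w∈)
    ... | x′ , y′ , x′<y′ , x′y′ , inj₁ (as , bs , eq)
      with disjoint x y x′ y′ x<y x′<y′ xy x′y′ z z∈inner (∈edgePath⇒∈inner (subst (z ∈_) (sym eq) (∈-++⁺ʳ as (here refl))))
    ... | refl , refl = here (sym (trans (cong (successor z) eq) (successor-unique as bs (subst Unique eq !P))))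
    ⊆ends {w} w∈ | x′ , y′ , x′<y′ , x′y′ , inj₂ (as , bs , eq)
      with disjoint x y x′ y′ x<y x′<y′ xy x′y′ z z∈inner (∈edgePath⇒∈inner (subst (z ∈_) (sym eq) (∈-++⁺ʳ as (there (here refl)))))
    ... | refl , refl = there (here (sym (trans (cong (successor z) reverse-eq)
                          (successor-unique (reverse bs) (reverse as) (subst Unique reverse-eq (Unique-reverse !P))))))
      where
      reverse-eq : reverse P ≡ reverse bs ++ z ∷ w ∷ reverse as
      reverse-eq = trans (cong reverse eq) (reverse-middle as w z bs)

  branchStructure : ∀ {Δ} → (∀ x → degree H x ≤ Δ) → BranchStructure G Δ
  branchStructure H-degree = record
    { isBranch           = isBranch
    ; branch-degree      = branch-degree H-degree
    ; inner-degree       = inner-degree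
    ; branch-independent = branch-independent
    }

RepetitivelyColoured-map⁻ : ∀ (f : Fin k → Fin n) {φ ψ} q → (∀ j → lookup φ (f j) ≡ lookup ψ j) →
                            RepetitivelyColoured φ (map f q) → RepetitivelyColoured ψ q
RepetitivelyColoured-map⁻ f {φ} {ψ} q φf≡ψ (as , bs , eq , as≢[] , |as|≡|bs| , φas≡φbs)
  with map-≡-++⁻ f q as bs eq
... | q₁ , q₂ , refl , refl , refl =
  q₁ , q₂ , refl , (λ { refl → as≢[] refl }) ,
  trans (sym (Listₚ.length-map f q₁)) (trans |as|≡|bs| (Listₚ.length-map f q₂)) ,
  (begin
    map (lookup ψ) q₁        ≡⟨ Listₚ.map-cong (sym ∘ φf≡ψ) q₁ ⟩
    map (lookup φ ∘ f) q₁    ≡⟨ Listₚ.map-∘ q₁ ⟩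
    map (lookup φ) (map f q₁) ≡⟨ φas≡φbs ⟩
    map (lookup φ) (map f q₂) ≡⟨ Listₚ.map-∘ q₂ ⟨
    map (lookup φ ∘ f) q₂    ≡⟨ Listₚ.map-cong φf≡ψ q₂ ⟩
    map (lookup ψ) q₂        ∎)
  where open ≡-Reasoning

RepetitivelyColoured-map⁺ : ∀ (f : Fin k → Fin n) {φ ψ} q → (∀ j → lookup φ (f j) ≡ lookup ψ j) →
                            RepetitivelyColoured ψ q → RepetitivelyColoured φ (map f q)
RepetitivelyColoured-map⁺ f {φ} {ψ} q φf≡ψ (as , bs , refl , as≢[] , |as|≡|bs| , ψas≡ψbs) =
  map f as , map f bs , Listₚ.map-++ f as bs , map≢[] as as≢[] ,
  trans (Listₚ.length-map f as) (trans |as|≡|bs| (sym (Listₚ.length-map f bs))) ,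
  (begin
    map (lookup φ) (map f as) ≡⟨ Listₚ.map-∘ as ⟨
    map (lookup φ ∘ f) as    ≡⟨ Listₚ.map-cong φf≡ψ as ⟩
    map (lookup ψ) as        ≡⟨ ψas≡ψbs ⟩
    map (lookup ψ) bs        ≡⟨ Listₚ.map-cong φf≡ψ bs ⟨
    map (lookup φ ∘ f) bs    ≡⟨ Listₚ.map-∘ bs ⟩
    map (lookup φ) (map f bs) ∎)
  where
  open ≡-Reasoning
  map≢[] : ∀ xs → xs ≢ [] → map f xs ≢ []
  map≢[] []      xs≢[] _ = xs≢[] refl
  map≢[] (_ ∷ _) _     ()

punchOut-all : ∀ {v : Fin (suc n)} p → All (v ≢_) p → List (Fin n)
punchOut-all []      []          = []
punchOut-all (z ∷ p) (v≢z ∷ v∉p) = punchOut v≢z ∷ punchOut-all p v∉p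

punchIn-punchOut-all : ∀ {v : Fin (suc n)} p (v∉p : All (v ≢_) p) → map (punchIn v) (punchOut-all p v∉p) ≡ p
punchIn-punchOut-all []      []          = refl
punchIn-punchOut-all (z ∷ p) (v≢z ∷ v∉p) = cong₂ _∷_ (Finₚ.punchIn-punchOut v≢z) (punchIn-punchOut-all p v∉p)

module WholeGraph {n} (G : Graph (suc n)) (L : ListAssignment (suc n)) (L-unique : ∀ z → Unique (L z)) (v : Fin (suc n)) where

  open Enumeration G L L-unique

  everything : VertexSet (suc n)
  everything _ = true

  length≡Π-everything : ∀ {xs} → Enumerates (NonrepLColouring G L) xs → length xs ≡ Π everything
  length≡Π-everything xs-enum = Enumerates-length-cong xs-enum (enumerate-correct everything)
    (λ φ (in-L , nonrep) → record
      { in-lists     = λ z _ → in-L z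
      ; zero-outside = λ z ()
      ; nonrep       = λ (p , path , _ , rep) → nonrep p path rep
      })
    (λ φ c → let open NonrepLColouringOf c in
      (λ z → in-lists z tt) , (λ p path rep → nonrep (p , path , All.tabulate (λ _ → tt) , rep)))

  G-v : Graph n
  G-v = G -v v

  L-v : ListAssignment n
  L-v = L ∘ punchIn v

  insert : Colouring n → Colouring (suc n)
  insert ψ = Vec.insertAt ψ v 0

  ≢v : ∀ {z} → z ∈ᵛ (everything ─ [ v ]) → v ≢ z
  ≢v {z} z∈ v≡z = proj₂ (∈ᵛ-─⁻ everything [ v ] z z∈) (here (sym v≡z))

  punchIn∈ᵛ : ∀ j → punchIn v j ∈ᵛ (everything ─ [ v ])
  punchIn∈ᵛ j = ∈ᵛ-─⁺ everything [ v ] (punchIn v j) tt λ { (here eq) → Finₚ.punchInᵢ≢i v j eq }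

  insert-good : ∀ ψ → NonrepLColouring G-v L-v ψ → NonrepLColouringOf G L (everything ─ [ v ]) (insert ψ)
  insert-good ψ (in-L , nonrep) = record
    { in-lists     = λ z z∈ → let v≢z = ≢v z∈ in
                       subst (λ x → lookup (insert ψ) x ∈ L x) (Finₚ.punchIn-punchOut v≢z)
                         (subst (_∈ L (punchIn v (punchOut v≢z))) (sym (Vecₚ.insertAt-punchIn ψ v 0 _)) (in-L _))
    ; zero-outside = λ z z∉ → [ (λ ()) , (λ { (here refl) → Vecₚ.insertAt-lookup ψ v 0 }) ]′ (∉ᵛ-─⁻ everything [ v ] z z∉)
    ; nonrep       = λ (p , path , inside , rep) →
        let v∉p = All.map ≢v inside
            q   = punchOut-all p v∉p
            q↑≡p = punchIn-punchOut-all p v∉p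
        in nonrep q (Uniqueₚ.map⁻ (subst Unique (sym q↑≡p) (proj₁ path)) ,
                     Linkedₚ.map⁻ (subst (Linked (Adj G)) (sym q↑≡p) (proj₂ path)))
             (RepetitivelyColoured-map⁻ (punchIn v) {insert ψ} {ψ} q (Vecₚ.insertAt-punchIn ψ v 0)
               (subst (RepetitivelyColoured (insert ψ)) (sym q↑≡p) rep))
    }

  remove-good : ∀ φ → NonrepLColouringOf G L (everything ─ [ v ]) φ →
                insert (Vec.removeAt φ v) ≡ φ × NonrepLColouring G-v L-v (Vec.removeAt φ v)
  remove-good φ c = insert-remove , (λ j → subst (_∈ L (punchIn v j)) (φ↑≡ψ j) (in-lists (punchIn v j) (punchIn∈ᵛ j))) ,
    λ q (!q , linked) rep → nonrep (map (punchIn v) q ,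
      (Uniqueₚ.map⁺ (Finₚ.punchIn-injective v _ _) !q , Linkedₚ.map⁺ linked) ,
      All.tabulate (λ z∈ → let j , _ , z≡ = ∈-map⁻ (punchIn v) z∈ in subst (_∈ᵛ (everything ─ [ v ])) (sym z≡) (punchIn∈ᵛ j)) ,
      RepetitivelyColoured-map⁺ (punchIn v) {φ} {ψ} q φ↑≡ψ rep)
    where
    open NonrepLColouringOf c
    ψ : Colouring n
    ψ = Vec.removeAt φ v
    insert-remove : insert ψ ≡ φ
    insert-remove = trans (cong (Vec.insertAt ψ v) (sym (zero-outside v (∉ᵛ-─⁺ʳ everything [ v ] v (here refl)))))
                          (Vecₚ.insertAt-removeAt φ v)
    φ↑≡ψ : ∀ j → lookup φ (punchIn v j) ≡ lookup ψ j
    φ↑≡ψ j = trans (cong (λ φ → lookup φ (punchIn v j)) (sym insert-remove)) (Vecₚ.insertAt-punchIn ψ v 0 j)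

  length≡Π-everything-v : ∀ {ys} → Enumerates (NonrepLColouring G-v L-v) ys → length ys ≡ Π (everything ─ [ v ])
  length≡Π-everything-v {ys} ys-enum = trans (sym (Listₚ.length-map insert ys))
    (Enumerates-length-cong inserted (enumerate-correct (everything ─ [ v ])) (λ _ c → c) (λ _ c → c))
    where
    inserted : Enumerates (NonrepLColouringOf G L (everything ─ [ v ])) (map insert ys)
    inserted = record
      { unique   = Uniqueₚ.map⁺ (λ {ψ} {ψ′} eq → trans (sym (Vecₚ.removeAt-insertAt ψ v 0))
                                   (trans (cong (λ φ → Vec.removeAt φ v) eq) (Vecₚ.removeAt-insertAt ψ′ v 0)))
                                (Enumerates.unique ys-enum)
      ; sound    = All.tabulate λ φ∈ → let ψ , ψ∈ , φ≡ = ∈-map⁻ insert φ∈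
                                       in subst (NonrepLColouringOf G L _) (sym φ≡)
                                            (insert-good ψ (All.lookup (Enumerates.sound ys-enum) ψ∈))
      ; complete = λ φ c → let insert-remove , ψ-good = remove-good φ c
                           in subst (_∈ map insert ys) insert-remove (∈-map⁺ insert (Enumerates.complete ys-enum _ ψ-good))
      }

lemma85 : (Δ : ℕ) → 2 ≤ Δ → (r : ℚ) → (r>0 : 0ℚ ℚ.< r) → (r<1 : r ℚ.< 1ℚ) →
          ∀ {k n} (H : Graph k) (G : Graph (suc n)) →
          MaxDegree H Δ → Subdivision H G →
          (L : ListAssignment (suc n)) → IsListAssignment (cBound Δ r r>0 r<1) L →
          (v : Fin (suc n)) →
          (xs : List (Colouring (suc n))) → Enumerates (NonrepLColouring G L) xs →
          (ys : List (Colouring n)) → Enumerates (NonrepLColouring (G -v v) (L ∘ punchIn v)) ys →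
          beta Δ r r>0 ℚ.* ℕ→ℚ (length ys) ℚ.≤ ℕ→ℚ (length xs)
lemma85 Δ 2≤Δ r r>0 r<1 H G (H-degree , _) subdivision L L-large v xs xs-enum ys ys-enum =
  subst₂ (λ a b → beta Δ r r>0 ℚ.* ℕ→ℚ a ℚ.≤ ℕ→ℚ b) (sym (length≡Π-everything-v ys-enum)) (sym (length≡Π-everything xs-enum))
    (β-removal everything v tt)
  where
  L-unique : ∀ z → Unique (L z)
  L-unique = proj₁ ∘ L-large
  open WholeGraph G L L-unique v
  open MainInequality L-unique 2≤Δ (SubdivisionBranches.branchStructure subdivision H-degree) r>0 (p<1⇒0<1-p r<1)
                      (λ z → ceiling≤⇒≤ _ (length (L z)) (proj₂ (L-large z)))
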